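{- Let $\Phi$ be a reduced root system in $V=\mathbb{R}\otimes\mathbb{Z}\Phi$ with simple roots $\Pi$ and positive roots $\Phi^+$, let $\mathcal{I}$ be an ideal of $\Phi^+$, and let $\Phi_0$ be a maximal standard parabolic subsystem such that $(\mathcal{I},\Phi_0)$ satisfies Condition (C). Let $\mathcal{I}_0=\mathcal{I}\cap\Phi_0^+$ and $\delta\in\Phi_0^c\cap\mathcal{I}^c$. Then the restriction $\mathcal{A}_\mathcal{I}^{H_\delta}=\{H_\delta\cap H: H\in\mathcal{A}_\mathcal{I}\setminus\{H_\delta\}\}$ is isomorphic to the arrangement of ideal type $\mathcal{A}_{\mathcal{I}_0}=\{H_\gamma:\gamma\in\Phi_0^+\setminus\mathcal{I}_0\}$.
   Context: Heights $\mathrm{ht}(\sum_{\alpha\in\Pi}c_\alpha\alpha)=\sum c_\alpha$; $\alpha\preceq\beta$ iff $\beta-\alpha$ is a $\mathbb{Z}_{\ge0}$-combination of positive roots or $\alpha=\beta$. An ideal of $\Phi^+$ is $\mathcal{I}\subseteq\Phi^+$ with $\alpha\in\mathcal{I},\beta\in\Phi^+,\alpha+\beta\in\Phi^+\Rightarrow\alpha+\beta\in\mathcal{I}$; $\mathcal{I}^c=\Phi^+\setminus\mathcal{I}$; $H_\alpha$ the hyperplane orthogonal to $\alpha$; $\mathcal{A}_\mathcal{I}=\{H_\alpha:\alpha\in\mathcal{I}^c\}$. A maximal standard parabolic subsystem is $\Phi_0=\mathbb{Z}\Pi_0\cap\Phi$ with $\Pi_0\subset\Pi$, $|\Pi_0|=|\Pi|-1$;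 $\Phi_0^+=\Phi_0\cap\Phi^+$, $\Phi_0^c=\Phi^+\setminus\Phi_0^+$. Condition (C) for $(\mathcal{I},\Phi_0)$: $\Phi_0^c\cap\mathcal{I}^c\ne\varnothing$; it is totally ordered by $\preceq$ with exactly one root of each occurring height; and for any distinct $\alpha,\beta$ in it there is $\gamma\in\Phi_0^+$ with $\alpha,\beta,\gamma$ linearly dependent. Isomorphism of arrangements here means that the map $H_\gamma\mapsto H_\delta\cap H_\gamma$ is a bijection from $\mathcal{A}_{\mathcal{I}_0}$ onto the restriction inducing an isomorphism of intersection lattices $Y\mapsto Y\cap H_\delta$.
   Formalization: The space $V$ is taken over the rationals instead of the reals, with an inner product whose Gram matrix on the simple roots is rational, so the hyperplanes $H_\alpha$ and their intersections are rational subspaces. -}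

module Defs where

open import Level using (Level)
open import Data.Nat using (ℕ)
open import Data.Integer as ℤ using (ℤ; +_)
open import Data.Rational as ℚ using (ℚ; 0ℚ; 1ℚ)
open import Data.Fin as Fin using (Fin)
open import Data.Vec as Vec using (Vec; lookup; tabulate; zipWith; replicate)
open import Data.Vec.Relation.Unary.All as VAll using ()
open import Data.List as List using (List; []; _∷_; length)
open import Data.List.Relation.Unary.All using (All)
open import Data.List.Relation.Unary.Any using (Any)
open import Data.List.Membership.Propositional using (_∈_)
open import Data.Product using (Σ; ∃; ∃-syntax; _×_; _,_)
open import Data.Sum using (_⊎_)
open import Data.Unit using (⊤)
open import Data.Bool using (if_then_else_)
open import Relation.Nullary using (¬_; does)
open import Relation.Binary.PropositionalEquality using (_≡_; _≢_)

-- We fix the basis of V given by the simple roots Π: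
-- V = ℚ^n (Vec ℚ n), the i-th simple root is the i-th unit vector, and
-- (by definition of a base) every root is a ℤ-combination of Π, so a
-- root is stored as its integer coordinate vector (Vec ℤ n).

V : ℕ → Set
V n = Vec ℚ n

Vecℤ : ℕ → Set
Vecℤ n = Vec ℤ n

emb : ∀ {n} → Vecℤ n → V n
emb = Vec.map (λ z → z ℚ./ 1)

zeroV : ∀ {n} → V n
zeroV = replicate _ 0ℚ

_+V_ : ∀ {n} → V n → V n → V n
_+V_ = zipWith ℚ._+_

_·V_ : ∀ {n} → ℚ → V n → V n
c ·V x = Vec.map (c ℚ.*_) x

zeroZ : ∀ {n} → Vecℤ n
zeroZ = replicate _ (+ 0)

_+Z_ : ∀ {n} → Vecℤ n → Vecℤ n → Vecℤ n
_+Z_ = zipWith ℤ._+_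

_-Z_ : ∀ {n} → Vecℤ n → Vecℤ n → Vecℤ n
_-Z_ = zipWith ℤ._-_

_·Z_ : ∀ {n} → ℤ → Vecℤ n → Vecℤ n
c ·Z x = Vec.map (c ℤ.*_) x

negZ : ∀ {n} → Vecℤ n → Vecℤ n
negZ = Vec.map (λ z → ℤ.- z)

simple : ∀ {n} → Fin n → Vecℤ n
simple i = tabulate (λ j → if does (i Fin.≟ j) then + 1 else + 0)

sumℚ : ∀ {m} → Vec ℚ m → ℚ
sumℚ v = List.foldr ℚ._+_ 0ℚ (Vec.toList v)

sumℤ : ∀ {m} → Vec ℤ m → ℤ
sumℤ v = List.foldr ℤ._+_ (+ 0) (Vec.toList v)

sumZs : ∀ {n} → List (Vecℤ n) → Vecℤ n
sumZs = List.foldr _+Z_ zeroZ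

-- bilinear form given by its Gram matrix B (in the basis Π)
form : ∀ {n} → (Fin n → Fin n → ℚ) → V n → V n → ℚ
form B x y = sumℚ (tabulate λ i → sumℚ (tabulate λ j →
               lookup x i ℚ.* B i j ℚ.* lookup y j))

-- linear combination  Σ cᵢ vᵢ  (extra entries ignored)
lincomb : ∀ {n} → List ℚ → List (V n) → V n
lincomb (c ∷ cs) (v ∷ vs) = (c ·V v) +V lincomb cs vs
lincomb _ _ = zeroV

LinDep : ∀ {n} → List (V n) → Set
LinDep vs = ∃[ cs ] (length cs ≡ length vs) × Any (λ c → c ≢ 0ℚ) cs
                    × lincomb cs vs ≡ zeroV

-- Reduced (crystallographic) root system Φ with base Π = unit vectors,
-- inner product ⟨x,y⟩ = form B x y (symmetric, positive definite).

record RootSystemWithBase (n : ℕ) : Set where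
  field
    Φ : List (Vecℤ n)
    B : Fin n → Fin n → ℚ
    B-sym : ∀ i j → B i j ≡ B j i
    B-posdef : ∀ (x : V n) → x ≢ zeroV → 0ℚ ℚ.< form B x x
    nonzero : ∀ α → α ∈ Φ → α ≢ zeroZ
    -- Π ⊆ Φ  (Π spans V, so Φ spans V)
    simple∈Φ : ∀ i → simple i ∈ Φ
    -- Π is a base: every root has all coefficients ≥ 0 or all ≤ 0
    signs : ∀ α → α ∈ Φ →
      VAll.All (ℤ._≤_ (+ 0)) α ⊎ VAll.All (λ z → z ℤ.≤ + 0) α
    -- crystallographic + reflection closed:
    --   c = 2⟨β,α⟩/⟨α,α⟩ ∈ ℤ  and  s_α(β) = β - c α ∈ Φ
    reflect : ∀ α β → α ∈ Φ → β ∈ Φ →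
      ∃[ c ] ((+ 2 ℚ./ 1) ℚ.* form B (emb β) (emb α) ≡ (c ℚ./ 1) ℚ.* form B (emb α) (emb α))
             × ((β -Z (c ·Z α)) ∈ Φ)
    reduced : ∀ α β → α ∈ Φ → β ∈ Φ →
      LinDep (emb α ∷ emb β ∷ []) → β ≡ α ⊎ β ≡ negZ α

Sub : ℕ → Set₁
Sub n = V n → Set

_∩_ : ∀ {n} → Sub n → Sub n → Sub n
(Y ∩ Z) x = Y x × Z x

_⊆_ : ∀ {n} → Sub n → Sub n → Set
Y ⊆ Z = ∀ x → Y x → Z x

_≐_ : ∀ {n} → Sub n → Sub n → Set
Y ≐ Z = (Y ⊆ Z) × (Z ⊆ Y)

⋂ : ∀ {n} → List (Sub n) → Sub n
⋂ = List.foldr _∩_ (λ _ → ⊤)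

module _ {n : ℕ} (R : RootSystemWithBase n) where
  open RootSystemWithBase R

  Pos : Vecℤ n → Set
  Pos α = α ∈ Φ × VAll.All (ℤ._≤_ (+ 0)) α

  ht : Vecℤ n → ℤ
  ht = sumℤ

  _⪯_ : Vecℤ n → Vecℤ n → Set
  α ⪯ β = (∃[ L ] All Pos L × sumZs L ≡ β -Z α) ⊎ α ≡ β

  IsIdeal : (Vecℤ n → Set) → Set
  IsIdeal I = (∀ α → I α → Pos α)
            × (∀ α β → I α → Pos β → (α +Z β) ∈ Φ → I (α +Z β))

  Compl : (Vecℤ n → Set) → Vecℤ n → Set
  Compl I α = Pos α × ¬ I α

  H : Vecℤ n → Sub n
  H α x = form B x (emb α) ≡ 0ℚ

  -- Maximal standard parabolic subsystem with Π₀ = Π ∖ {simple k}: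
  -- Φ₀ = ℤΠ₀ ∩ Φ = roots whose k-th coordinate (Π-coefficient) is 0.
  InΦ₀ : Fin n → Vecℤ n → Set
  InΦ₀ k α = α ∈ Φ × lookup α k ≡ + 0

  Φ₀⁺ : Fin n → Vecℤ n → Set
  Φ₀⁺ k α = InΦ₀ k α × Pos α

  Φ₀ᶜ : Fin n → Vecℤ n → Set
  Φ₀ᶜ k α = Pos α × ¬ Φ₀⁺ k α

  ConditionC : (Vecℤ n → Set) → Fin n → Set
  ConditionC I k =
      (∃[ α ] S α)
    × (∀ α β → S α → S β → α ⪯ β ⊎ β ⪯ α)
    × (∀ α β → S α → S β → ht α ≡ ht β → α ≡ β)
    × (∀ α β → S α → S β → α ≢ β →
         ∃[ γ ] Φ₀⁺ k γ × LinDep (emb α ∷ emb β ∷ emb γ ∷ []))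
    where
      S : Vecℤ n → Set
      S α = Φ₀ᶜ k α × Compl I α

  I₀ : (Vecℤ n → Set) → Fin n → Vecℤ n → Set
  I₀ I k α = I α × Φ₀⁺ k α

  A₀ : (Vecℤ n → Set) → Fin n → Vecℤ n → Set
  A₀ I k γ = Φ₀⁺ k γ × ¬ I₀ I k γ

  ResRoot : (Vecℤ n → Set) → Vecℤ n → Vecℤ n → Set
  ResRoot I δ α = Compl I α × ¬ (H α ≐ H δ)

  FlatA₀ : (Vecℤ n → Set) → Fin n → Sub n → Set
  FlatA₀ I k Y = ∃[ L ] All (A₀ I k) L × Y ≐ ⋂ (List.map H L)

  -- intersection lattice of the restriction 𝒜_I^{H_δ}
  -- (the empty intersection is the ambient space H_δ)
  FlatRes : (Vecℤ n → Set) → Vecℤ n → Sub n → Set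
  FlatRes I δ W = ∃[ L ] All (ResRoot I δ) L × W ≐ (H δ ∩ ⋂ (List.map H L))

  -- The isomorphism notion of the paper: H_γ ↦ H_δ ∩ H_γ is a bijection
  -- 𝒜_{I₀} → 𝒜_I^{H_δ}, and Y ↦ Y ∩ H_δ is an isomorphism of the
  -- intersection lattices (bijective, order preserving and reflecting).
  record IsoRestriction (I : Vecℤ n → Set) (k : Fin n) (δ : Vecℤ n) : Set₁ where
    field
      hyp-into : ∀ γ → A₀ I k γ →
        ∃[ α ] ResRoot I δ α × (H δ ∩ H γ) ≐ (H δ ∩ H α)
      hyp-inj : ∀ γ γ′ → A₀ I k γ → A₀ I k γ′ →
        (H δ ∩ H γ) ≐ (H δ ∩ H γ′) → H γ ≐ H γ′
      hyp-surj : ∀ α → ResRoot I δ α →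
        ∃[ γ ] A₀ I k γ × (H δ ∩ H α) ≐ (H δ ∩ H γ)
      lat-into : ∀ Y → FlatA₀ I k Y → FlatRes I δ (Y ∩ H δ)
      lat-mono : ∀ Y Z → FlatA₀ I k Y → FlatA₀ I k Z →
        Y ⊆ Z → (Y ∩ H δ) ⊆ (Z ∩ H δ)
      lat-refl : ∀ Y Z → FlatA₀ I k Y → FlatA₀ I k Z →
        (Y ∩ H δ) ⊆ (Z ∩ H δ) → Y ⊆ Z
      lat-surj : ∀ W → FlatRes I δ W →
        ∃[ Y ] FlatA₀ I k Y × (Y ∩ H δ) ≐ W

module Submission where

-- Coordinates are taken in the basis Π, so Φ₀ = roots with k-th coordinate
-- 0.  Two ingredients:
--  * Traces.  Flats spanned by roots of Φ₀ lie in the hyperplane x_k = 0,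
--    which does not contain δ.  Gram–Schmidt yields w orthogonal to given
--    roots of Φ₀ but not to δ; moving points along w into H_δ shows that
--    restriction to H_δ reflects inclusions of such flats.  This gives
--    injectivity and the lattice part of the isomorphism.
--  * Surjectivity.  For α ∈ Iᶜ ∖ Φ₀, Condition (C) (only its linear
--    dependence clause is needed) gives γ ∈ Φ₀⁺ with the same trace on
--    H_δ as α.  That γ ∉ I is the heart of the proof: a descent on
--    k-coordinates, driven by the ideal property and the classical fact that
--    roots at an acute angle differ by a root.

open import Defs
open import Data.Nat as ℕ using (ℕ; zero; suc)
import Data.Nat.Properties as ℕP
open import Data.Integer as ℤ using (ℤ; +_)
import Data.Integer.Properties as ℤP
open import Data.Rational as ℚ using (ℚ; mkℚ; 0ℚ; 1ℚ; ↥_; _<_; _≤_)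
import Data.Rational.Properties as ℚP
import Data.Nat.Coprimality as Coprime
open import Data.Fin as Fin using (Fin)
open import Data.Vec as Vec using (Vec; lookup; tabulate)
import Data.Vec.Properties as VecP
import Data.Vec.Relation.Unary.All as VAll
import Data.Vec.Relation.Unary.All.Properties as VAllP
open import Data.Vec.Functional using (Vector)
open import Algebra.Bundles using (Ring)
import Algebra.Properties.Semiring.Sum
open import Data.List as List using (List; []; _∷_)
import Data.List.Relation.Unary.All.Properties as AllP
open import Data.List.Relation.Unary.Any using (Any; here; there)
open import Data.List.Relation.Unary.All as All using (All; []; _∷_)
open import Data.List.Membership.Propositional using (_∈_)
open import Data.Product using (Σ; ∃-syntax; _×_; _,_; proj₁; proj₂; swap)
open import Data.Sum using (_⊎_; inj₁; inj₂)
open import Data.Empty using (⊥; ⊥-elim)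
open import Relation.Nullary using (¬_; Dec; yes; no)
open import Data.Unit using (⊤; tt)
open import Relation.Binary.PropositionalEquality
open import Function using (_∘_)
import Data.Rational.Solver as ℚSolver
import Data.Integer.Solver as ℤSolver

ι : ℤ → ℚ
ι z = z ℚ./ 1

ι-normal : ∀ z → ι z ≡ mkℚ z 0 (Coprime.sym (Coprime.1-coprimeTo _))
ι-normal z = ℚP.↥p/↧p≡p (mkℚ z 0 (Coprime.sym (Coprime.1-coprimeTo _)))

ι-+ : ∀ a b → ι (a ℤ.+ b) ≡ ι a ℚ.+ ι b
ι-+ a b rewrite ι-normal a | ι-normal b =
  ℚP./-cong (solve 2 (λ a b → a :+ b := a :* con (+ 1) :+ b :* con (+ 1)) refl a b) refl
  where open ℤSolver.+-*-Solver

ι-* : ∀ a b → ι (a ℤ.* b) ≡ ι a ℚ.* ι b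
ι-* a b rewrite ι-normal a | ι-normal b = refl

ι-neg : ∀ a → ι (ℤ.- a) ≡ ℚ.- ι a
ι-neg (+ zero) = refl
ι-neg ℤ.+[1+ m ] rewrite ι-normal ℤ.+[1+ m ] = refl
ι-neg ℤ.-[1+ m ] rewrite ι-normal ℤ.+[1+ m ] = refl

ι-injective : ∀ a b → ι a ≡ ι b → a ≡ b
ι-injective a b eq = trans (sym (cong ↥_ (ι-normal a))) (trans (cong ↥_ eq) (cong ↥_ (ι-normal b)))

ι-≢0 : ∀ {a} → a ≢ + 0 → ι a ≢ 0ℚ
ι-≢0 {a} a≢0 eq = a≢0 (ι-injective a (+ 0) eq)

ι-mono-< : ∀ {a b} → a ℤ.< b → ι a < ι b
ι-mono-< {a} {b} lt rewrite ι-normal a | ι-normal b =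
  ℚ.*<* (subst₂ ℤ._<_ (sym (ℤP.*-identityʳ a)) (sym (ℤP.*-identityʳ b)) lt)

ι-cancel-< : ∀ {a b} → ι a < ι b → a ℤ.< b
ι-cancel-< {a} {b} lt rewrite ι-normal a | ι-normal b with lt
... | ℚ.*<* p = subst₂ ℤ._<_ (ℤP.*-identityʳ a) (ℤP.*-identityʳ b) p

pos*pos : ∀ {x y} → 0ℚ < x → 0ℚ < y → 0ℚ < x ℚ.* y
pos*pos {x} {y} p q =
  ℚP.positive⁻¹ (x ℚ.* y) {{ℚP.pos*pos⇒pos x {{ℚ.positive p}} y {{ℚ.positive q}}}}

nonPos*nonPos : ∀ {x y} → x ≤ 0ℚ → y ≤ 0ℚ → 0ℚ ≤ x ℚ.* y
nonPos*nonPos {x} {y} p q =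
  ℚP.nonNegative⁻¹ (x ℚ.* y) {{ℚP.nonPos*nonPos⇒nonPos x {{ℚ.nonPositive p}} y {{ℚ.nonPositive q}}}}

pos-factor : ∀ {x y} → 0ℚ < x ℚ.* y → 0ℚ < y → 0ℚ < x
pos-factor {x} {y} p q =
  ℚP.*-cancelʳ-<-nonNeg y {{ℚ.nonNegative (ℚP.<⇒≤ q)}} (subst (_< x ℚ.* y) (sym (ℚP.*-zeroˡ y)) p)

pos+nonNeg : ∀ {x y} → 0ℚ < x → 0ℚ ≤ y → 0ℚ < x ℚ.+ y
pos+nonNeg {x} {y} p q = subst (_< x ℚ.+ y) (ℚP.+-identityʳ 0ℚ) (ℚP.+-mono-<-≤ p q)

pos⇒≢0 : ∀ {x} → 0ℚ < x → x ≢ 0ℚ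
pos⇒≢0 p e = ℚP.<⇒≢ p (sym e)

zero-product : ∀ {x y} → x ℚ.* y ≡ 0ℚ → x ≢ 0ℚ → y ≡ 0ℚ
zero-product {x} {y} xy≡0 x≢0 = begin
    y                      ≡⟨ sym (ℚP.*-identityˡ y) ⟩
    1ℚ ℚ.* y               ≡⟨ cong (ℚ._* y) (sym (ℚP.*-inverseˡ x {{nz}})) ⟩
    (x⁻¹ ℚ.* x) ℚ.* y      ≡⟨ ℚP.*-assoc x⁻¹ x y ⟩
    x⁻¹ ℚ.* (x ℚ.* y)      ≡⟨ cong (x⁻¹ ℚ.*_) xy≡0 ⟩
    x⁻¹ ℚ.* 0ℚ             ≡⟨ ℚP.*-zeroʳ x⁻¹ ⟩
    0ℚ                     ∎
  where
  open ≡-Reasoning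
  nz = ℚ.≢-nonZero x≢0
  x⁻¹ = ℚ.1/_ x {{nz}}

*-≢0 : ∀ {x y} → x ≢ 0ℚ → y ≢ 0ℚ → x ℚ.* y ≢ 0ℚ
*-≢0 x≢0 y≢0 xy≡0 = y≢0 (zero-product xy≡0 x≢0)

*-cancelʳ : ∀ {a b x} → a ℚ.* x ≡ b ℚ.* x → x ≢ 0ℚ → a ≡ b
*-cancelʳ {a} {b} {x} eq x≢0 = begin
    a                    ≡⟨ solve 2 (λ a b → a := (a :- b) :+ b) refl a b ⟩
    (a ℚ.- b) ℚ.+ b      ≡⟨ cong (ℚ._+ b) (zero-product diff x≢0) ⟩
    0ℚ ℚ.+ b             ≡⟨ ℚP.+-identityˡ b ⟩
    b                    ∎
  where
  open ≡-Reasoning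
  open ℚSolver.+-*-Solver
  diff : x ℚ.* (a ℚ.- b) ≡ 0ℚ
  diff = begin
    x ℚ.* (a ℚ.- b)      ≡⟨ solve 3 (λ a b x → x :* (a :- b) := a :* x :- b :* x) refl a b x ⟩
    a ℚ.* x ℚ.- b ℚ.* x  ≡⟨ cong (ℚ._- b ℚ.* x) eq ⟩
    b ℚ.* x ℚ.- b ℚ.* x  ≡⟨ ℚP.+-inverseʳ (b ℚ.* x) ⟩
    0ℚ                   ∎

-- The third terms b·y, b·s vanish and only record the shape in which such
-- equations arise from a three-term relation.
eliminate : ∀ {a₁ a₂ b x₁ x₂ y r₁ r₂ s} →
  a₁ ℚ.* x₁ ℚ.+ (a₂ ℚ.* x₂ ℚ.+ b ℚ.* y) ≡ 0ℚ → a₁ ℚ.* r₁ ℚ.+ (a₂ ℚ.* r₂ ℚ.+ b ℚ.* s) ≡ 0ℚ →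
  y ≡ 0ℚ → s ≡ 0ℚ → a₁ ≢ 0ℚ → x₁ ℚ.* r₂ ≡ x₂ ℚ.* r₁
eliminate {a₁} {a₂} {b} {x₁} {x₂} {_} {r₁} {r₂} eq₁ eq₂ refl refl a₁≢0 =
  *-cancelʳ {x₁ ℚ.* r₂} {x₂ ℚ.* r₁} {a₁} (begin
    x₁ ℚ.* r₂ ℚ.* a₁
      ≡⟨ solve 7 (λ a₁ a₂ b x₁ x₂ r₁ r₂ →
            x₁ :* r₂ :* a₁ := (a₁ :* x₁ :+ (a₂ :* x₂ :+ b :* con 0ℚ)) :* r₂
                              :- (a₁ :* r₁ :+ (a₂ :* r₂ :+ b :* con 0ℚ)) :* x₂ :+ x₂ :* r₁ :* a₁)
               refl a₁ a₂ b x₁ x₂ r₁ r₂ ⟩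
    (a₁ ℚ.* x₁ ℚ.+ (a₂ ℚ.* x₂ ℚ.+ b ℚ.* 0ℚ)) ℚ.* r₂ ℚ.- (a₁ ℚ.* r₁ ℚ.+ (a₂ ℚ.* r₂ ℚ.+ b ℚ.* 0ℚ)) ℚ.* x₂
      ℚ.+ x₂ ℚ.* r₁ ℚ.* a₁
      ≡⟨ cong₂ (λ p q → p ℚ.* r₂ ℚ.- q ℚ.* x₂ ℚ.+ x₂ ℚ.* r₁ ℚ.* a₁) eq₁ eq₂ ⟩
    0ℚ ℚ.* r₂ ℚ.- 0ℚ ℚ.* x₂ ℚ.+ x₂ ℚ.* r₁ ℚ.* a₁
      ≡⟨ solve 4 (λ r₂ x₂ r₁ a₁ → con 0ℚ :* r₂ :- con 0ℚ :* x₂ :+ x₂ :* r₁ :* a₁ := x₂ :* r₁ :* a₁)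
               refl r₂ x₂ r₁ a₁ ⟩
    x₂ ℚ.* r₁ ℚ.* a₁ ∎) a₁≢0
  where
  open ≡-Reasoning
  open ℚSolver.+-*-Solver

∣+∣-nonNeg : ∀ {i j} → + 0 ℤ.≤ i → + 0 ℤ.≤ j → ℤ.∣ i ℤ.+ j ∣ ≡ ℤ.∣ i ∣ ℕ.+ ℤ.∣ j ∣
∣+∣-nonNeg (ℤ.+≤+ _) (ℤ.+≤+ _) = refl

∣∣-pos : ∀ {i} → + 0 ℤ.< i → 0 ℕ.< ℤ.∣ i ∣
∣∣-pos (ℤ.+<+ 0<i) = 0<i

-- Positive integers whose product is below 4 include a 1.  (This is what
-- makes the possible angles between two roots so restricted.)
product<4⇒one : ∀ c c′ → + 0 ℤ.< c → + 0 ℤ.< c′ → + 0 ℤ.< + 4 ℤ.- c ℤ.* c′ →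
                c ≡ + 1 ⊎ c′ ≡ + 1
product<4⇒one (+ suc zero) c′ _ _ _ = inj₁ refl
product<4⇒one (+ suc (suc a)) (+ suc zero) _ _ _ = inj₂ refl
product<4⇒one (+ suc (suc a)) (+ suc (suc b)) _ _ bound =
  ⊥-elim (ℤP.<-irrefl refl (ℤP.<-≤-trans bound (ℤP.i≤j⇒i-j≤0 4≤cc′)))
  where
  4≤cc′ : + 4 ℤ.≤ + suc (suc a) ℤ.* + suc (suc b)
  4≤cc′ = subst (+ 4 ℤ.≤_) (ℤP.pos-* (suc (suc a)) (suc (suc b)))
            (ℤ.+≤+ (ℕP.*-mono-≤ {2} {suc (suc a)} {2} {suc (suc b)}
                      (ℕ.s≤s (ℕ.s≤s ℕ.z≤n)) (ℕ.s≤s (ℕ.s≤s ℕ.z≤n))))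
product<4⇒one (+ zero) _ (ℤ.+<+ ()) _ _
product<4⇒one (+ suc (suc a)) (+ zero) _ (ℤ.+<+ ()) _

vec-ext : ∀ {A : Set} {m} (x y : Vec A m) → (∀ i → lookup x i ≡ lookup y i) → x ≡ y
vec-ext x y p = trans (sym (VecP.tabulate∘lookup x)) (trans (VecP.tabulate-cong p) (VecP.tabulate∘lookup y))

module _ {m : ℕ} where

  lookup-+V : ∀ (x y : V m) i → lookup (x +V y) i ≡ lookup x i ℚ.+ lookup y i
  lookup-+V x y i = VecP.lookup-zipWith ℚ._+_ i x y

  lookup-·V : ∀ c (x : V m) i → lookup (c ·V x) i ≡ c ℚ.* lookup x i
  lookup-·V c x i = VecP.lookup-map i (c ℚ.*_) x

  lookup-zeroV : ∀ i → lookup (zeroV {m}) i ≡ 0ℚ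
  lookup-zeroV i = VecP.lookup-replicate i 0ℚ

  lookup-emb : ∀ (α : Vecℤ m) i → lookup (emb α) i ≡ ι (lookup α i)
  lookup-emb α i = VecP.lookup-map i _ α

  lookup-+Z : ∀ (x y : Vecℤ m) i → lookup (x +Z y) i ≡ lookup x i ℤ.+ lookup y i
  lookup-+Z x y i = VecP.lookup-zipWith ℤ._+_ i x y

  lookup--Z : ∀ (x y : Vecℤ m) i → lookup (x -Z y) i ≡ lookup x i ℤ.- lookup y i
  lookup--Z x y i = VecP.lookup-zipWith ℤ._-_ i x y

  lookup-·Z : ∀ c (x : Vecℤ m) i → lookup (c ·Z x) i ≡ c ℤ.* lookup x i
  lookup-·Z c x i = VecP.lookup-map i (c ℤ.*_) x

  lookup-negZ : ∀ (x : Vecℤ m) i → lookup (negZ x) i ≡ ℤ.- lookup x i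
  lookup-negZ x i = VecP.lookup-map i _ x

  lookup-zeroZ : ∀ i → lookup (zeroZ {m}) i ≡ + 0
  lookup-zeroZ i = VecP.lookup-replicate i (+ 0)

  emb-+Z : ∀ (x y : Vecℤ m) → emb (x +Z y) ≡ emb x +V emb y
  emb-+Z x y = vec-ext _ _ λ i → begin
      lookup (emb (x +Z y)) i                 ≡⟨ lookup-emb (x +Z y) i ⟩
      ι (lookup (x +Z y) i)                   ≡⟨ cong ι (lookup-+Z x y i) ⟩
      ι (lookup x i ℤ.+ lookup y i)           ≡⟨ ι-+ (lookup x i) (lookup y i) ⟩
      ι (lookup x i) ℚ.+ ι (lookup y i)       ≡⟨ sym (cong₂ ℚ._+_ (lookup-emb x i) (lookup-emb y i)) ⟩
      lookup (emb x) i ℚ.+ lookup (emb y) i   ≡⟨ sym (lookup-+V (emb x) (emb y) i) ⟩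
      lookup (emb x +V emb y) i               ∎
    where open ≡-Reasoning

  emb-≢0 : ∀ (x : Vecℤ m) → x ≢ zeroZ → emb x ≢ zeroV
  emb-≢0 x x≢0 e = x≢0 (vec-ext _ _ λ i →
    trans (ι-injective _ _ (trans (sym (lookup-emb x i)) (trans (cong (λ v → lookup v i) e) (lookup-zeroV i))))
          (sym (lookup-zeroZ i)))

  +V-zeroV : ∀ (x : V m) → x +V zeroV ≡ x
  +V-zeroV x = vec-ext _ _ λ i →
    trans (lookup-+V x zeroV i) (trans (cong (lookup x i ℚ.+_) (lookup-zeroV i)) (ℚP.+-identityʳ _))

  negZ--Z : ∀ (x y : Vecℤ m) → negZ (x -Z y) ≡ y -Z x
  negZ--Z x y = vec-ext _ _ λ i → begin
      lookup (negZ (x -Z y)) i           ≡⟨ lookup-negZ (x -Z y) i ⟩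
      ℤ.- lookup (x -Z y) i              ≡⟨ cong ℤ.-_ (lookup--Z x y i) ⟩
      ℤ.- (lookup x i ℤ.- lookup y i)    ≡⟨ solve 2 (λ a b → :- (a :- b) := b :- a) refl (lookup x i) (lookup y i) ⟩
      lookup y i ℤ.- lookup x i          ≡⟨ sym (lookup--Z y x i) ⟩
      lookup (y -Z x) i                  ∎
    where
    open ≡-Reasoning
    open ℤSolver.+-*-Solver

  +Z--Z : ∀ (x y : Vecℤ m) → x +Z (y -Z x) ≡ y
  +Z--Z x y = vec-ext _ _ λ i → begin
      lookup (x +Z (y -Z x)) i               ≡⟨ lookup-+Z x (y -Z x) i ⟩
      lookup x i ℤ.+ lookup (y -Z x) i       ≡⟨ cong (λ t → lookup x i ℤ.+ t) (lookup--Z y x i) ⟩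
      lookup x i ℤ.+ (lookup y i ℤ.- lookup x i) ≡⟨ solve 2 (λ a b → a :+ (b :- a) := b) refl (lookup x i) (lookup y i) ⟩
      lookup y i                             ∎
    where
    open ≡-Reasoning
    open ℤSolver.+-*-Solver

  +Z-comm : ∀ (x y : Vecℤ m) → x +Z y ≡ y +Z x
  +Z-comm x y = vec-ext _ _ λ i →
    trans (lookup-+Z x y i) (trans (ℤP.+-comm (lookup x i) (lookup y i)) (sym (lookup-+Z y x i)))

  -Z-·Z-one : ∀ (x y : Vecℤ m) → x -Z ((+ 1) ·Z y) ≡ x -Z y
  -Z-·Z-one x y = vec-ext _ _ λ i →
    trans (lookup--Z x ((+ 1) ·Z y) i)
          (trans (cong (λ t → lookup x i ℤ.- t) (trans (lookup-·Z (+ 1) y i) (ℤP.*-identityˡ _))) (sym (lookup--Z x y i)))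

module FiniteSum = Algebra.Properties.Semiring.Sum (Ring.semiring ℚP.+-*-ring)
open FiniteSum using (sum)

sumℚ-tabulate : ∀ {m} (f : Vector ℚ m) → sumℚ (tabulate f) ≡ sum f
sumℚ-tabulate {zero} f = refl
sumℚ-tabulate {suc m} f = cong (f Fin.zero ℚ.+_) (sumℚ-tabulate (f ∘ Fin.suc))

module BilinearForm {m : ℕ} (B : Fin m → Fin m → ℚ) (B-sym : ∀ i j → B i j ≡ B j i) where

  ∑ : Vector ℚ m → ℚ
  ∑ = sum

  ⟨_,_⟩ : V m → V m → ℚ
  ⟨_,_⟩ = form B

  term : V m → V m → Fin m → Fin m → ℚ
  term x y i j = lookup x i ℚ.* B i j ℚ.* lookup y j

  form-sum : ∀ x y → ⟨ x , y ⟩ ≡ ∑ (λ i → ∑ (λ j → term x y i j))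
  form-sum x y = trans (sumℚ-tabulate (λ i → sumℚ (tabulate (term x y i))))
                       (FiniteSum.sum-cong-≗ (λ i → sumℚ-tabulate (term x y i)))

  double-sum-cong : ∀ {f g : Fin m → Fin m → ℚ} → (∀ i j → f i j ≡ g i j) →
                    ∑ (λ i → ∑ (f i)) ≡ ∑ (λ i → ∑ (g i))
  double-sum-cong p = FiniteSum.sum-cong-≗ (λ i → FiniteSum.sum-cong-≗ (p i))

  +ˡ : ∀ x y z → ⟨ x +V y , z ⟩ ≡ ⟨ x , z ⟩ ℚ.+ ⟨ y , z ⟩
  +ˡ x y z = begin
      ⟨ x +V y , z ⟩                                         ≡⟨ form-sum (x +V y) z ⟩
      ∑ (λ i → ∑ (λ j → term (x +V y) z i j))                ≡⟨ double-sum-cong split ⟩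
      ∑ (λ i → ∑ (λ j → term x z i j ℚ.+ term y z i j))      ≡⟨ FiniteSum.sum-cong-≗ (λ i → FiniteSum.∑-distrib-+ (term x z i) (term y z i)) ⟩
      ∑ (λ i → ∑ (term x z i) ℚ.+ ∑ (term y z i))            ≡⟨ FiniteSum.∑-distrib-+ (λ i → ∑ (term x z i)) (λ i → ∑ (term y z i)) ⟩
      ∑ (λ i → ∑ (term x z i)) ℚ.+ ∑ (λ i → ∑ (term y z i))  ≡⟨ sym (cong₂ ℚ._+_ (form-sum x z) (form-sum y z)) ⟩
      ⟨ x , z ⟩ ℚ.+ ⟨ y , z ⟩                                ∎
    where
    open ≡-Reasoning
    split : ∀ i j → term (x +V y) z i j ≡ term x z i j ℚ.+ term y z i j
    split i j rewrite lookup-+V x y i =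
      solve 4 (λ a b c d → (a :+ b) :* c :* d := a :* c :* d :+ b :* c :* d) refl
        (lookup x i) (lookup y i) (B i j) (lookup z j)
      where open ℚSolver.+-*-Solver

  ·ˡ : ∀ c x z → ⟨ c ·V x , z ⟩ ≡ c ℚ.* ⟨ x , z ⟩
  ·ˡ c x z = begin
      ⟨ c ·V x , z ⟩                           ≡⟨ form-sum (c ·V x) z ⟩
      ∑ (λ i → ∑ (λ j → term (c ·V x) z i j))  ≡⟨ double-sum-cong scale ⟩
      ∑ (λ i → ∑ (λ j → c ℚ.* term x z i j))   ≡⟨ FiniteSum.sum-cong-≗ (λ i → sym (FiniteSum.*-distribˡ-sum c (term x z i))) ⟩
      ∑ (λ i → c ℚ.* ∑ (term x z i))           ≡⟨ sym (FiniteSum.*-distribˡ-sum c (λ i → ∑ (term x z i))) ⟩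
      c ℚ.* ∑ (λ i → ∑ (term x z i))           ≡⟨ cong (c ℚ.*_) (sym (form-sum x z)) ⟩
      c ℚ.* ⟨ x , z ⟩                          ∎
    where
    open ≡-Reasoning
    scale : ∀ i j → term (c ·V x) z i j ≡ c ℚ.* term x z i j
    scale i j rewrite lookup-·V c x i =
      solve 4 (λ a b c d → (a :* b) :* c :* d := a :* (b :* c :* d)) refl c (lookup x i) (B i j) (lookup z j)
      where open ℚSolver.+-*-Solver

  sym-form : ∀ x y → ⟨ x , y ⟩ ≡ ⟨ y , x ⟩
  sym-form x y = begin
      ⟨ x , y ⟩                         ≡⟨ form-sum x y ⟩
      ∑ (λ i → ∑ (λ j → term x y i j))  ≡⟨ FiniteSum.∑-comm (term x y) ⟩
      ∑ (λ j → ∑ (λ i → term x y i j))  ≡⟨ double-sum-cong transpose ⟩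
      ∑ (λ j → ∑ (λ i → term y x j i))  ≡⟨ sym (form-sum y x) ⟩
      ⟨ y , x ⟩                         ∎
    where
    open ≡-Reasoning
    transpose : ∀ j i → term x y i j ≡ term y x j i
    transpose j i rewrite B-sym i j =
      solve 3 (λ a b c → a :* b :* c := c :* b :* a) refl (lookup x i) (B j i) (lookup y j)
      where open ℚSolver.+-*-Solver

  zeroˡ : ∀ z → ⟨ zeroV , z ⟩ ≡ 0ℚ
  zeroˡ z = begin
      ⟨ zeroV , z ⟩                         ≡⟨ form-sum zeroV z ⟩
      ∑ (λ i → ∑ (λ j → term zeroV z i j))  ≡⟨ double-sum-cong vanish ⟩
      ∑ (λ i → ∑ (λ j → 0ℚ))                ≡⟨ FiniteSum.sum-cong-≗ {m} (λ i → FiniteSum.sum-replicate-zero m) ⟩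
      ∑ (λ i → 0ℚ)                          ≡⟨ FiniteSum.sum-replicate-zero m ⟩
      0ℚ                                    ∎
    where
    open ≡-Reasoning
    vanish : ∀ i j → term zeroV z i j ≡ 0ℚ
    vanish i j rewrite lookup-zeroV {m} i = trans (cong (ℚ._* lookup z j) (ℚP.*-zeroˡ (B i j))) (ℚP.*-zeroˡ (lookup z j))

  zeroʳ : ∀ z → ⟨ z , zeroV ⟩ ≡ 0ℚ
  zeroʳ z = trans (sym-form z zeroV) (zeroˡ z)

  ⊥-all : V m → List (V m) → Set
  ⊥-all w bs = All (λ b → ⟨ w , b ⟩ ≡ 0ℚ) bs

  combˡ : ∀ a x c y z → ⟨ (a ·V x) +V (c ·V y) , z ⟩ ≡ a ℚ.* ⟨ x , z ⟩ ℚ.+ c ℚ.* ⟨ y , z ⟩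
  combˡ a x c y z = trans (+ˡ (a ·V x) (c ·V y) z) (cong₂ ℚ._+_ (·ˡ a x z) (·ˡ c y z))

  combʳ : ∀ a x c y z → ⟨ z , (a ·V x) +V (c ·V y) ⟩ ≡ a ℚ.* ⟨ z , x ⟩ ℚ.+ c ℚ.* ⟨ z , y ⟩
  combʳ a x c y z = trans (sym-form z ((a ·V x) +V (c ·V y))) (trans (combˡ a x c y z)
                      (cong₂ (λ p q → a ℚ.* p ℚ.+ c ℚ.* q) (sym-form x z) (sym-form y z)))

  comb₃ : ℚ → V m → ℚ → V m → ℚ → V m → V m
  comb₃ a u b v c w = (a ·V u) +V ((b ·V v) +V (c ·V w))

  lookup-comb₃ : ∀ a u b v c w i →
    lookup (comb₃ a u b v c w) i ≡ a ℚ.* lookup u i ℚ.+ (b ℚ.* lookup v i ℚ.+ c ℚ.* lookup w i)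
  lookup-comb₃ a u b v c w i =
    trans (lookup-+V (a ·V u) _ i)
          (cong₂ ℚ._+_ (lookup-·V a u i)
                 (trans (lookup-+V (b ·V v) (c ·V w) i) (cong₂ ℚ._+_ (lookup-·V b v i) (lookup-·V c w i))))

  record Relation₃ (a : ℚ) (u : V m) (b : ℚ) (v : V m) (c : ℚ) (w : V m) : Set where
    constructor relation
    field vanishes : comb₃ a u b v c w ≡ zeroV

  relation-at : ∀ {a u b v c w} → Relation₃ a u b v c w →
    ∀ i → a ℚ.* lookup u i ℚ.+ (b ℚ.* lookup v i ℚ.+ c ℚ.* lookup w i) ≡ 0ℚ
  relation-at {a} {u} {b} {v} {c} {w} (relation rel) i =
    trans (sym (lookup-comb₃ a u b v c w i)) (trans (cong (λ x → lookup x i) rel) (lookup-zeroV i))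

  relation-from-coordinates : ∀ a u b v c w →
    (∀ i → a ℚ.* lookup u i ℚ.+ (b ℚ.* lookup v i ℚ.+ c ℚ.* lookup w i) ≡ 0ℚ) → Relation₃ a u b v c w
  relation-from-coordinates a u b v c w p =
    relation (vec-ext _ _ λ i → trans (lookup-comb₃ a u b v c w i) (trans (p i) (sym (lookup-zeroV i))))

  form-comb₃ : ∀ a u b v c w z →
    ⟨ comb₃ a u b v c w , z ⟩ ≡ a ℚ.* ⟨ u , z ⟩ ℚ.+ (b ℚ.* ⟨ v , z ⟩ ℚ.+ c ℚ.* ⟨ w , z ⟩)
  form-comb₃ a u b v c w z =
    trans (+ˡ (a ·V u) _ z) (cong₂ ℚ._+_ (·ˡ a u z) (combˡ b v c w z))

  relation-paired : ∀ {a u b v c w} → Relation₃ a u b v c w →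
    ∀ z → a ℚ.* ⟨ u , z ⟩ ℚ.+ (b ℚ.* ⟨ v , z ⟩ ℚ.+ c ℚ.* ⟨ w , z ⟩) ≡ 0ℚ
  relation-paired {a} {u} {b} {v} {c} {w} (relation rel) z =
    trans (sym (form-comb₃ a u b v c w z)) (trans (cong ⟨_, z ⟩ rel) (zeroˡ z))

  -- x ↦ ⟨u,a⟩·x − ⟨x,a⟩·u  moves x parallel to u into the hyperplane a⊥
  -- (scaled by ⟨u,a⟩).  It is the common step of Gram–Schmidt
  -- orthogonalisation and of the restriction arguments below.
  projectAlong : V m → V m → V m → V m
  projectAlong u a x = (⟨ u , a ⟩ ·V x) +V ((ℚ.- ⟨ x , a ⟩) ·V u)

  projectAlong-⊥ : ∀ u a x → ⟨ projectAlong u a x , a ⟩ ≡ 0ℚ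
  projectAlong-⊥ u a x =
    trans (combˡ ⟨ u , a ⟩ x (ℚ.- ⟨ x , a ⟩) u a)
          (solve 2 (λ p q → p :* q :+ (:- q) :* p := con 0ℚ) refl ⟨ u , a ⟩ ⟨ x , a ⟩)
    where open ℚSolver.+-*-Solver

  projectAlong-form : ∀ u a x y → ⟨ u , y ⟩ ≡ 0ℚ → ⟨ projectAlong u a x , y ⟩ ≡ ⟨ u , a ⟩ ℚ.* ⟨ x , y ⟩
  projectAlong-form u a x y u⊥y = begin
      ⟨ projectAlong u a x , y ⟩                                  ≡⟨ combˡ ⟨ u , a ⟩ x (ℚ.- ⟨ x , a ⟩) u y ⟩
      ⟨ u , a ⟩ ℚ.* ⟨ x , y ⟩ ℚ.+ ℚ.- ⟨ x , a ⟩ ℚ.* ⟨ u , y ⟩     ≡⟨ cong (λ t → ⟨ u , a ⟩ ℚ.* ⟨ x , y ⟩ ℚ.+ ℚ.- ⟨ x , a ⟩ ℚ.* t) u⊥y ⟩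
      ⟨ u , a ⟩ ℚ.* ⟨ x , y ⟩ ℚ.+ ℚ.- ⟨ x , a ⟩ ℚ.* 0ℚ            ≡⟨ solve 3 (λ p q r → p :* q :+ (:- r) :* con 0ℚ := p :* q) refl ⟨ u , a ⟩ ⟨ x , y ⟩ ⟨ x , a ⟩ ⟩
      ⟨ u , a ⟩ ℚ.* ⟨ x , y ⟩                                     ∎
    where
    open ≡-Reasoning
    open ℚSolver.+-*-Solver

  lookup-projectAlong : ∀ u a x k → lookup u k ≡ 0ℚ → lookup (projectAlong u a x) k ≡ ⟨ u , a ⟩ ℚ.* lookup x k
  lookup-projectAlong u a x k uₖ≡0 = begin
      lookup (projectAlong u a x) k                                  ≡⟨ lookup-+V (⟨ u , a ⟩ ·V x) _ k ⟩
      lookup (⟨ u , a ⟩ ·V x) k ℚ.+ lookup ((ℚ.- ⟨ x , a ⟩) ·V u) k  ≡⟨ cong₂ ℚ._+_ (lookup-·V ⟨ u , a ⟩ x k) (lookup-·V (ℚ.- ⟨ x , a ⟩) u k) ⟩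
      ⟨ u , a ⟩ ℚ.* lookup x k ℚ.+ ℚ.- ⟨ x , a ⟩ ℚ.* lookup u k      ≡⟨ cong (λ t → ⟨ u , a ⟩ ℚ.* lookup x k ℚ.+ ℚ.- ⟨ x , a ⟩ ℚ.* t) uₖ≡0 ⟩
      ⟨ u , a ⟩ ℚ.* lookup x k ℚ.+ ℚ.- ⟨ x , a ⟩ ℚ.* 0ℚ             ≡⟨ solve 3 (λ p q r → p :* q :+ (:- r) :* con 0ℚ := p :* q) refl ⟨ u , a ⟩ (lookup x k) ⟨ x , a ⟩ ⟩
      ⟨ u , a ⟩ ℚ.* lookup x k                                       ∎
    where
    open ≡-Reasoning
    open ℚSolver.+-*-Solver

dependent₂ : ∀ {m} a (u : V m) b v → (a ≢ 0ℚ ⊎ b ≢ 0ℚ) →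
  (∀ i → a ℚ.* lookup u i ℚ.+ b ℚ.* lookup v i ≡ 0ℚ) → LinDep (u ∷ v ∷ [])
dependent₂ a u b v nontrivial rel = (a ∷ b ∷ []) , refl , witness nontrivial ,
  vec-ext _ _ λ i → begin
    lookup ((a ·V u) +V ((b ·V v) +V zeroV)) i            ≡⟨ cong (λ x → lookup ((a ·V u) +V x) i) (+V-zeroV (b ·V v)) ⟩
    lookup ((a ·V u) +V (b ·V v)) i                        ≡⟨ lookup-+V (a ·V u) (b ·V v) i ⟩
    lookup (a ·V u) i ℚ.+ lookup (b ·V v) i                ≡⟨ cong₂ ℚ._+_ (lookup-·V a u i) (lookup-·V b v i) ⟩
    a ℚ.* lookup u i ℚ.+ b ℚ.* lookup v i                  ≡⟨ rel i ⟩
    0ℚ                                                      ≡⟨ sym (lookup-zeroV i) ⟩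
    lookup zeroV i                                          ∎
  where
  open ≡-Reasoning
  witness : (a ≢ 0ℚ ⊎ b ≢ 0ℚ) → Any (λ c → c ≢ 0ℚ) (a ∷ b ∷ [])
  witness (inj₁ a≢0) = here a≢0
  witness (inj₂ b≢0) = there (here b≢0)

-- For a positive definite form,
-- finitely many vectors v with v_k = 0 and a vector d with d_k ≠ 0 can be
-- separated: some w is orthogonal to all the v but not to d.  (Their span
-- lies in the hyperplane x_k = 0, which does not contain d.)  We obtain w
-- by orthogonalising d against an orthogonal basis of the span.

module Separation {m : ℕ} (B : Fin m → Fin m → ℚ) (B-sym : ∀ i j → B i j ≡ B j i)
                  (B-posdef : ∀ x → x ≢ zeroV → 0ℚ < form B x x) (k : Fin m) where
  open BilinearForm B B-sym

  Orthogonal : List (V m) → Set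
  Orthogonal [] = ⊤
  Orthogonal (b ∷ bs) = ⊥-all b bs × Orthogonal bs

  -- Gram–Schmidt step without normalisation
  orthogonalise : List (V m) → V m → V m
  orthogonalise [] v = v
  orthogonalise (b ∷ bs) v = projectAlong b b (orthogonalise bs v)

  scaling : List (V m) → ℚ
  scaling [] = 1ℚ
  scaling (b ∷ bs) = ⟨ b , b ⟩ ℚ.* scaling bs

  scaling-≢0 : ∀ bs → All (_≢ zeroV) bs → scaling bs ≢ 0ℚ
  scaling-≢0 [] [] ()
  scaling-≢0 (b ∷ bs) (b≢0 ∷ bs≢0) = *-≢0 (pos⇒≢0 (B-posdef b b≢0)) (scaling-≢0 bs bs≢0)

  orthogonalise-⊥ : ∀ bs v → Orthogonal bs → ⊥-all (orthogonalise bs v) bs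
  orthogonalise-⊥ [] v _ = []
  orthogonalise-⊥ (b ∷ bs) v (b⊥bs , orth) =
    projectAlong-⊥ b b u ∷ keep (orthogonalise-⊥ bs v orth) b⊥bs
    where
    u = orthogonalise bs v
    keep : ∀ {cs} → ⊥-all u cs → ⊥-all b cs → ⊥-all (projectAlong b b u) cs
    keep [] [] = []
    keep {c ∷ _} (u⊥c ∷ u⊥cs) (b⊥c ∷ b⊥cs) =
      trans (projectAlong-form b b u c b⊥c) (trans (cong (⟨ b , b ⟩ ℚ.*_) u⊥c) (ℚP.*-zeroʳ ⟨ b , b ⟩))
      ∷ keep u⊥cs b⊥cs

  orthogonalise-form : ∀ bs v w → ⊥-all w bs → ⟨ w , orthogonalise bs v ⟩ ≡ scaling bs ℚ.* ⟨ w , v ⟩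
  orthogonalise-form [] v w [] = sym (ℚP.*-identityˡ _)
  orthogonalise-form (b ∷ bs) v w (w⊥b ∷ w⊥bs) = begin
      ⟨ w , projectAlong b b u ⟩                  ≡⟨ sym-form w (projectAlong b b u) ⟩
      ⟨ projectAlong b b u , w ⟩                  ≡⟨ projectAlong-form b b u w (trans (sym-form b w) w⊥b) ⟩
      ⟨ b , b ⟩ ℚ.* ⟨ u , w ⟩                     ≡⟨ cong (⟨ b , b ⟩ ℚ.*_) (trans (sym-form u w) (orthogonalise-form bs v w w⊥bs)) ⟩
      ⟨ b , b ⟩ ℚ.* (scaling bs ℚ.* ⟨ w , v ⟩)    ≡⟨ sym (ℚP.*-assoc ⟨ b , b ⟩ (scaling bs) ⟨ w , v ⟩) ⟩
      scaling (b ∷ bs) ℚ.* ⟨ w , v ⟩             ∎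
    where
    open ≡-Reasoning
    u = orthogonalise bs v

  InHyperplane : V m → Set
  InHyperplane v = lookup v k ≡ 0ℚ

  lookup-orthogonalise : ∀ bs v → All InHyperplane bs → lookup (orthogonalise bs v) k ≡ scaling bs ℚ.* lookup v k
  lookup-orthogonalise [] v [] = sym (ℚP.*-identityˡ _)
  lookup-orthogonalise (b ∷ bs) v (bₖ ∷ bsₖ) =
    trans (lookup-projectAlong b b (orthogonalise bs v) k bₖ)
          (trans (cong (⟨ b , b ⟩ ℚ.*_) (lookup-orthogonalise bs v bsₖ))
                 (sym (ℚP.*-assoc ⟨ b , b ⟩ (scaling bs) (lookup v k))))

  record OrthogonalBasis (L : List (V m)) : Set where
    field
      basis      : List (V m)
      orthogonal : Orthogonal basis
      nonzero    : All (_≢ zeroV) basis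
      in-plane   : All InHyperplane basis
      spans      : ∀ w → ⊥-all w basis → ⊥-all w L

  extend : ∀ {L} v → InHyperplane v → OrthogonalBasis L → OrthogonalBasis (v ∷ L)
  extend {L} v vₖ ob = by-cases (VecP.≡-dec ℚP._≟_ v′ zeroV)
    where
    open OrthogonalBasis ob
    v′ = orthogonalise basis v
    ⊥v : ∀ w → ⊥-all w basis → ⟨ w , v′ ⟩ ≡ 0ℚ → ⟨ w , v ⟩ ≡ 0ℚ
    ⊥v w w⊥ p = zero-product (trans (sym (orthogonalise-form basis v w w⊥)) p) (scaling-≢0 basis nonzero)
    by-cases : Dec (v′ ≡ zeroV) → OrthogonalBasis (v ∷ L)
    by-cases (yes v′≡0) = record
      { basis = basis ; orthogonal = orthogonal ; nonzero = nonzero ; in-plane = in-plane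
      ; spans = λ w w⊥ → ⊥v w w⊥ (trans (cong ⟨ w ,_⟩ v′≡0) (zeroʳ w)) ∷ spans w w⊥ }
    by-cases (no v′≢0) = record
      { basis = v′ ∷ basis
      ; orthogonal = orthogonalise-⊥ basis v orthogonal , orthogonal
      ; nonzero = v′≢0 ∷ nonzero
      ; in-plane = trans (lookup-orthogonalise basis v in-plane)
                         (trans (cong (scaling basis ℚ.*_) vₖ) (ℚP.*-zeroʳ (scaling basis))) ∷ in-plane
      ; spans = λ { w (w⊥v′ ∷ w⊥) → ⊥v w w⊥ w⊥v′ ∷ spans w w⊥ }
      }

  orthogonal-basis : ∀ L → All InHyperplane L → OrthogonalBasis L
  orthogonal-basis [] [] = record
    { basis = [] ; orthogonal = tt ; nonzero = [] ; in-plane = [] ; spans = λ _ _ → [] }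
  orthogonal-basis (v ∷ L) (vₖ ∷ Lₖ) = extend v vₖ (orthogonal-basis L Lₖ)

  separating-vector : ∀ L d → All InHyperplane L → lookup d k ≢ 0ℚ →
                      Σ (V m) λ w → ⊥-all w L × ⟨ w , d ⟩ ≢ 0ℚ
  separating-vector L d Lₖ dₖ≢0 = w , spans w (orthogonalise-⊥ basis d orthogonal) , w·d≢0
    where
    open OrthogonalBasis (orthogonal-basis L Lₖ)
    w = orthogonalise basis d
    wₖ≢0 : lookup w k ≢ 0ℚ
    wₖ≢0 = subst (_≢ 0ℚ) (sym (lookup-orthogonalise basis d in-plane)) (*-≢0 (scaling-≢0 basis nonzero) dₖ≢0)
    w≢0 : w ≢ zeroV
    w≢0 w≡0 = wₖ≢0 (trans (cong (λ v → lookup v k) w≡0) (lookup-zeroV k))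
    -- ⟨w,w⟩ = scaling · ⟨w,d⟩  and  ⟨w,w⟩ > 0
    w·d≢0 : ⟨ w , d ⟩ ≢ 0ℚ
    w·d≢0 w·d≡0 = pos⇒≢0 (B-posdef w w≢0)
      (trans (orthogonalise-form basis d w (orthogonalise-⊥ basis d orthogonal))
             (trans (cong (scaling basis ℚ.*_) w·d≡0) (ℚP.*-zeroʳ (scaling basis))))

  -- Restricting to the hyperplane d⊥ loses no information about vectors of
  -- x_k = 0: if every x ⊥ d, x ⊥ L₁ satisfies x ⊥ L₂, then so does every
  -- x ⊥ L₁.  (Move x along a separating w into d⊥.)
  restriction-reflects : ∀ L₁ L₂ d → All InHyperplane L₁ → All InHyperplane L₂ → lookup d k ≢ 0ℚ →
    (∀ x → ⟨ x , d ⟩ ≡ 0ℚ → ⊥-all x L₁ → ⊥-all x L₂) → ∀ x → ⊥-all x L₁ → ⊥-all x L₂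
  restriction-reflects L₁ L₂ d L₁ₖ L₂ₖ dₖ≢0 on-d⊥ x x⊥L₁ =
    recover L₂ (on-d⊥ x′ (projectAlong-⊥ w d x) (move L₁ x⊥L₁ w⊥L₁)) w⊥L₂
    where
    separation = separating-vector (L₁ List.++ L₂) d (AllP.++⁺ L₁ₖ L₂ₖ) dₖ≢0
    w = proj₁ separation
    w⊥L₁ = AllP.++⁻ˡ L₁ (proj₁ (proj₂ separation))
    w⊥L₂ = AllP.++⁻ʳ L₁ (proj₁ (proj₂ separation))
    x′ = projectAlong w d x
    paired : ∀ {l} → ⟨ w , l ⟩ ≡ 0ℚ → ⟨ x′ , l ⟩ ≡ ⟨ w , d ⟩ ℚ.* ⟨ x , l ⟩
    paired {l} w⊥l = projectAlong-form w d x l w⊥l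
    move : ∀ L → ⊥-all x L → ⊥-all w L → ⊥-all x′ L
    move [] [] [] = []
    move (l ∷ L) (x⊥l ∷ x⊥L) (w⊥l ∷ w⊥L) =
      trans (paired {l} w⊥l) (trans (cong (⟨ w , d ⟩ ℚ.*_) x⊥l) (ℚP.*-zeroʳ ⟨ w , d ⟩)) ∷ move L x⊥L w⊥L
    recover : ∀ L → ⊥-all x′ L → ⊥-all w L → ⊥-all x L
    recover [] [] [] = []
    recover (l ∷ L) (x′⊥l ∷ x′⊥L) (w⊥l ∷ w⊥L) =
      zero-product (trans (sym (paired {l} w⊥l)) x′⊥l) (proj₂ (proj₂ separation)) ∷ recover L x′⊥L w⊥L

module RootSystemFacts {n : ℕ} (R : RootSystemWithBase n) where
  open RootSystemWithBase R
  open BilinearForm B B-sym public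

  ⟪_,_⟫ : Vecℤ n → Vecℤ n → ℚ
  ⟪ α , β ⟫ = ⟨ emb α , emb β ⟩

  norm-pos : ∀ {α} → α ∈ Φ → 0ℚ < ⟪ α , α ⟫
  norm-pos {α} α∈Φ = B-posdef (emb α) (emb-≢0 α (nonzero α α∈Φ))

  -- reflecting β in itself (Cartan integer 2) gives −β
  neg-root : ∀ {β} → β ∈ Φ → negZ β ∈ Φ
  neg-root {β} β∈Φ with reflect β β β∈Φ β∈Φ
  ... | c , 2β·β≡cβ·β , reflected = subst (_∈ Φ) twice-β (subst (λ c → β -Z (c ·Z β) ∈ Φ) c≡2 reflected)
    where
    c≡2 : c ≡ + 2
    c≡2 = sym (ι-injective (+ 2) c (*-cancelʳ 2β·β≡cβ·β (pos⇒≢0 (norm-pos β∈Φ))))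
    twice-β : β -Z ((+ 2) ·Z β) ≡ negZ β
    twice-β = vec-ext _ _ λ i →
      trans (lookup--Z β _ i) (trans (cong (λ t → lookup β i ℤ.- t) (lookup-·Z (+ 2) β i))
        (trans (solve 1 (λ b → b :- con (+ 2) :* b := :- b) refl (lookup β i)) (sym (lookup-negZ β i))))
      where open ℤSolver.+-*-Solver

  difference-root-sym : ∀ {α β} → (α -Z β) ∈ Φ → (β -Z α) ∈ Φ
  difference-root-sym {α} {β} h = subst (_∈ Φ) (negZ--Z α β) (neg-root h)

  NonNeg : Vecℤ n → Set
  NonNeg = VAll.All (ℤ._≤_ (+ 0))

  nonNeg-both-signs : ∀ {ρ} → ρ ∈ Φ → NonNeg ρ → ¬ NonNeg (negZ ρ)
  nonNeg-both-signs {ρ} ρ∈Φ ρ≥0 -ρ≥0 = nonzero ρ ρ∈Φ (vec-ext _ _ λ i →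
    trans (ℤP.≤-antisym (≤0 i) (VAllP.lookup⁺ ρ≥0 i)) (sym (lookup-zeroZ i)))
    where
    ≤0 : ∀ i → lookup ρ i ℤ.≤ + 0
    ≤0 i = subst (ℤ._≤ + 0) (ℤP.neg-involutive _)
             (ℤP.neg-mono-≤ (subst (+ 0 ℤ.≤_) (lookup-negZ ρ i) (VAllP.lookup⁺ -ρ≥0 i)))

  independent : ∀ {α β} → α ∈ Φ → β ∈ Φ → β ≢ α → β ≢ negZ α → ¬ LinDep (emb α ∷ emb β ∷ [])
  independent {α} {β} α∈Φ β∈Φ β≢α β≢-α dep with reduced α β α∈Φ β∈Φ dep
  ... | inj₁ β≡α = β≢α β≡α
  ... | inj₂ β≡-α = β≢-α β≡-α

  -- For non-proportional roots with Cartan integers c, c′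
  -- (2⟨β,α⟩ = c⟨α,α⟩,  2⟨α,β⟩ = c′⟨β,β⟩) we have c·c′ < 4, because the
  -- nonzero vector  −c·α + 2·β  has norm (4 − c c′)⟨β,β⟩.
  cartan-bound : ∀ {α β} c c′ → α ∈ Φ → β ∈ Φ → ¬ LinDep (emb α ∷ emb β ∷ []) →
    ι (+ 2) ℚ.* ⟪ β , α ⟫ ≡ ι c ℚ.* ⟪ α , α ⟫ →
    ι (+ 2) ℚ.* ⟪ α , β ⟫ ≡ ι c′ ℚ.* ⟪ β , β ⟫ →
    + 0 ℤ.< + 4 ℤ.- c ℤ.* c′
  cartan-bound {α} {β} c c′ α∈Φ β∈Φ indep cartan cartan′ =
    ι-cancel-< (subst (0ℚ <_) (sym ι-bound) (pos-factor (subst (0ℚ <_) norm-z (B-posdef z z≢0)) (norm-pos β∈Φ)))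
    where
    a = ⟪ α , α ⟫
    b = ⟪ β , β ⟫
    s = ⟪ α , β ⟫
    z : V n
    z = ((ℚ.- ι c) ·V emb α) +V (ι (+ 2) ·V emb β)
    z≢0 : z ≢ zeroV
    z≢0 z≡0 = indep (dependent₂ (ℚ.- ι c) (emb α) (ι (+ 2)) (emb β) (inj₂ (λ ()))
      λ i → trans (sym (trans (lookup-+V ((ℚ.- ι c) ·V emb α) (ι (+ 2) ·V emb β) i)
                                 (cong₂ ℚ._+_ (lookup-·V (ℚ.- ι c) (emb α) i) (lookup-·V (ι (+ 2)) (emb β) i))))
                  (trans (cong (λ v → lookup v i) z≡0) (lookup-zeroV i)))
    2s≡ca : ι (+ 2) ℚ.* s ≡ ι c ℚ.* a
    2s≡ca = trans (cong (ι (+ 2) ℚ.*_) (sym-form (emb α) (emb β))) cartan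
    norm-z : ⟨ z , z ⟩ ≡ (ι (+ 4) ℚ.+ ℚ.- (ι c ℚ.* ι c′)) ℚ.* b
    norm-z = begin
      ⟨ z , z ⟩
        ≡⟨ combˡ (ℚ.- ι c) (emb α) (ι (+ 2)) (emb β) z ⟩
      ℚ.- ι c ℚ.* ⟨ emb α , z ⟩ ℚ.+ ι (+ 2) ℚ.* ⟨ emb β , z ⟩
        ≡⟨ cong₂ (λ p q → ℚ.- ι c ℚ.* p ℚ.+ ι (+ 2) ℚ.* q)
                 (combʳ (ℚ.- ι c) (emb α) (ι (+ 2)) (emb β) (emb α))
                 (combʳ (ℚ.- ι c) (emb α) (ι (+ 2)) (emb β) (emb β)) ⟩
      ℚ.- ι c ℚ.* (ℚ.- ι c ℚ.* a ℚ.+ ι (+ 2) ℚ.* s) ℚ.+ ι (+ 2) ℚ.* (ℚ.- ι c ℚ.* ⟪ β , α ⟫ ℚ.+ ι (+ 2) ℚ.* b)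
        ≡⟨ cong (λ t → ℚ.- ι c ℚ.* (ℚ.- ι c ℚ.* a ℚ.+ ι (+ 2) ℚ.* s) ℚ.+ ι (+ 2) ℚ.* (ℚ.- ι c ℚ.* t ℚ.+ ι (+ 2) ℚ.* b))
                (sym-form (emb β) (emb α)) ⟩
      ℚ.- ι c ℚ.* (ℚ.- ι c ℚ.* a ℚ.+ ι (+ 2) ℚ.* s) ℚ.+ ι (+ 2) ℚ.* (ℚ.- ι c ℚ.* s ℚ.+ ι (+ 2) ℚ.* b)
        ≡⟨ solve 5 (λ C T A S Bb → (:- C) :* ((:- C) :* A :+ T :* S) :+ T :* ((:- C) :* S :+ T :* Bb)
                               := C :* (C :* A :- T :* S) :+ (T :* T :* Bb :- C :* (T :* S)))
                   refl (ι c) (ι (+ 2)) a s b ⟩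
      ι c ℚ.* (ι c ℚ.* a ℚ.- ι (+ 2) ℚ.* s) ℚ.+ (ι (+ 2) ℚ.* ι (+ 2) ℚ.* b ℚ.- ι c ℚ.* (ι (+ 2) ℚ.* s))
        ≡⟨ cong₂ (λ p q → ι c ℚ.* (p ℚ.- ι (+ 2) ℚ.* s) ℚ.+ (ι (+ 2) ℚ.* ι (+ 2) ℚ.* b ℚ.- ι c ℚ.* q))
                 (sym 2s≡ca) cartan′ ⟩
      ι c ℚ.* (ι (+ 2) ℚ.* s ℚ.- ι (+ 2) ℚ.* s) ℚ.+ (ι (+ 2) ℚ.* ι (+ 2) ℚ.* b ℚ.- ι c ℚ.* (ι c′ ℚ.* b))
        ≡⟨ solve 4 (λ C C′ S Bb → C :* (con (ι (+ 2)) :* S :- con (ι (+ 2)) :* S)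
                                   :+ (con (ι (+ 2)) :* con (ι (+ 2)) :* Bb :- C :* (C′ :* Bb))
                               := (con (ι (+ 4)) :+ :- (C :* C′)) :* Bb)
                   refl (ι c) (ι c′) s b ⟩
      (ι (+ 4) ℚ.+ ℚ.- (ι c ℚ.* ι c′)) ℚ.* b ∎
      where
      open ≡-Reasoning
      open ℚSolver.+-*-Solver
    ι-bound : ι (+ 4 ℤ.- c ℤ.* c′) ≡ ι (+ 4) ℚ.+ ℚ.- (ι c ℚ.* ι c′)
    ι-bound = trans (ι-+ (+ 4) (ℤ.- (c ℤ.* c′))) (cong (ι (+ 4) ℚ.+_) (trans (ι-neg (c ℤ.* c′)) (cong ℚ.-_ (ι-* c c′))))

  difference-root : ∀ {α β} → α ∈ Φ → β ∈ Φ → β ≢ α → β ≢ negZ α → 0ℚ < ⟪ α , β ⟫ → (β -Z α) ∈ Φ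
  difference-root {α} {β} α∈Φ β∈Φ β≢α β≢-α α·β>0
    with reflect α β α∈Φ β∈Φ | reflect β α β∈Φ α∈Φ
  ... | c , cartan , β-cα∈Φ | c′ , cartan′ , α-c′β∈Φ =
    conclude (product<4⇒one c c′ (positive cartan α∈Φ (subst (0ℚ <_) (sym-form (emb α) (emb β)) α·β>0))
                                (positive cartan′ β∈Φ α·β>0)
                                (cartan-bound c c′ α∈Φ β∈Φ (independent α∈Φ β∈Φ β≢α β≢-α) cartan cartan′))
    where
    positive : ∀ {γ x d} → ι (+ 2) ℚ.* x ≡ ι d ℚ.* ⟪ γ , γ ⟫ → γ ∈ Φ → 0ℚ < x → + 0 ℤ.< d
    positive eq γ∈Φ x>0 =
      ι-cancel-< (pos-factor (subst (0ℚ <_) eq (pos*pos (ι-mono-< {+ 0} {+ 2} (ℤ.+<+ (ℕ.s≤s ℕ.z≤n))) x>0)) (norm-pos γ∈Φ))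
    conclude : c ≡ + 1 ⊎ c′ ≡ + 1 → (β -Z α) ∈ Φ
    conclude (inj₁ refl) = subst (_∈ Φ) (-Z-·Z-one β α) β-cα∈Φ
    conclude (inj₂ refl) = difference-root-sym (subst (_∈ Φ) (-Z-·Z-one α β) α-c′β∈Φ)

-- Fix an ideal I and a root γ ∈ I ∩ Φ₀ (γ_k = 0)
-- and call the roots of Φ₀ᶜ ∩ Iᶜ outer.  Two distinct outer roots are never
-- related to γ by a relation a₁ρ₁ + a₂ρ₂ + bγ = 0 with a₁ ≠ 0.  Descent on
-- ρ₁_k + ρ₂_k: such a relation forces ⟨ρ₁,ρ₂⟩ > 0, so the two roots differ
-- by a positive root f; f ∉ Φ₀ (else f = γ and ρ₂ = γ + ρ₁ ∈ I), so f is
-- outer, related to the smaller of the two and of smaller k-coordinate.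

module Descent {n : ℕ} (R : RootSystemWithBase n) (I : Vecℤ n → Set) (isI : IsIdeal R I)
               (k : Fin n) (γ : Vecℤ n) (γ∈I : I γ) (γₖ≡0 : lookup γ k ≡ + 0) where
  open RootSystemWithBase R
  open RootSystemFacts R

  γ-pos : Pos R γ
  γ-pos = proj₁ isI γ γ∈I

  γ∈Φ : γ ∈ Φ
  γ∈Φ = proj₁ γ-pos

  γₖ≡0ℚ : lookup (emb γ) k ≡ 0ℚ
  γₖ≡0ℚ = trans (lookup-emb γ k) (cong ι γₖ≡0)

  ideal-sum : ∀ {α β ρ} → I α → Pos R β → α +Z β ≡ ρ → ρ ∈ Φ → I ρ
  ideal-sum {α} {β} α∈I β-pos refl ρ∈Φ = proj₂ isI α β α∈I β-pos ρ∈Φ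

  Outer : Vecℤ n → Set
  Outer ρ = Pos R ρ × lookup ρ k ≢ + 0 × ¬ I ρ

  outer-k-pos : ∀ {ρ} → Outer ρ → + 0 ℤ.< lookup ρ k
  outer-k-pos ((_ , ρ≥0) , ρₖ≢0 , _) = ℤP.≤∧≢⇒< (VAllP.lookup⁺ ρ≥0 k) (λ e → ρₖ≢0 (sym e))

  outer-kℚ-pos : ∀ {ρ} → Outer ρ → 0ℚ < lookup (emb ρ) k
  outer-kℚ-pos {ρ} o = subst (0ℚ <_) (sym (lookup-emb ρ k)) (ι-mono-< (outer-k-pos o))

  positive-by-k : ∀ {β} → β ∈ Φ → + 0 ℤ.< lookup β k → Pos R β
  positive-by-k {β} β∈Φ βₖ>0 with signs β β∈Φ
  ... | inj₁ β≥0 = β∈Φ , β≥0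
  ... | inj₂ β≤0 = ⊥-elim (ℤP.<-irrefl refl (ℤP.<-≤-trans βₖ>0 (VAllP.lookup⁺ β≤0 k)))

  -- an outer root makes an obtuse angle with γ: otherwise ρ − γ is a
  -- positive root and ρ = γ + (ρ − γ) ∈ I
  obtuse-with-γ : ∀ {ρ} → Outer ρ → ⟪ ρ , γ ⟫ ≤ 0ℚ
  obtuse-with-γ {ρ} o@((ρ∈Φ , _) , ρₖ≢0 , ρ∉I) with ⟪ ρ , γ ⟫ ℚP.≤? 0ℚ
  ... | yes ≤0 = ≤0
  ... | no ≰0 = ⊥-elim (ρ∉I (ideal-sum γ∈I (positive-by-k f∈Φ fₖ>0) (+Z--Z γ ρ) ρ∈Φ))
    where
    ρ≢γ : ρ ≢ γ
    ρ≢γ ρ≡γ = ρₖ≢0 (trans (cong (λ v → lookup v k) ρ≡γ) γₖ≡0)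
    ρ≢-γ : ρ ≢ negZ γ
    ρ≢-γ ρ≡-γ = ρₖ≢0 (trans (cong (λ v → lookup v k) ρ≡-γ) (trans (lookup-negZ γ k) (cong ℤ.-_ γₖ≡0)))
    f∈Φ : (ρ -Z γ) ∈ Φ
    f∈Φ = difference-root γ∈Φ ρ∈Φ ρ≢γ ρ≢-γ (subst (0ℚ <_) (sym-form (emb ρ) (emb γ)) (ℚP.≰⇒> ≰0))
    fₖ>0 : + 0 ℤ.< lookup (ρ -Z γ) k
    fₖ>0 = subst (+ 0 ℤ.<_) (sym (trans (lookup--Z ρ γ k) (trans (cong (λ t → lookup ρ k ℤ.- t) γₖ≡0) (ℤP.+-identityʳ _))))
                 (outer-k-pos o)

  record Related (ρ₁ ρ₂ : Vecℤ n) : Set where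
    constructor related
    field
      a₁ a₂ b : ℚ
      a₁≢0    : a₁ ≢ 0ℚ
      rel     : Relation₃ a₁ (emb ρ₁) a₂ (emb ρ₂) b (emb γ)

  relation-at-k : ∀ {ρ₁ ρ₂} (r : Related ρ₁ ρ₂) → let open Related r in
    a₁ ℚ.* lookup (emb ρ₁) k ℚ.+ (a₂ ℚ.* lookup (emb ρ₂) k ℚ.+ b ℚ.* 0ℚ) ≡ 0ℚ
  relation-at-k {ρ₁} {ρ₂} (related a₁ a₂ b _ rel) =
    subst (λ t → a₁ ℚ.* lookup (emb ρ₁) k ℚ.+ (a₂ ℚ.* lookup (emb ρ₂) k ℚ.+ b ℚ.* t) ≡ 0ℚ) γₖ≡0ℚ (relation-at rel k)

  -- for outer ρ₁ also a₂ ≠ 0 (look at coordinate k), so relatedness is symmetric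
  second-coefficient : ∀ {ρ₁ ρ₂} → Outer ρ₁ → (r : Related ρ₁ ρ₂) → Related.a₂ r ≢ 0ℚ
  second-coefficient {ρ₁} {ρ₂} o r@(related a₁ a₂ b a₁≢0 rel) a₂≡0 =
    pos⇒≢0 (outer-kℚ-pos o) (zero-product (trans
      (solve 4 (λ a r s b → a :* r := a :* r :+ (con 0ℚ :* s :+ b :* con 0ℚ)) refl a₁ (lookup (emb ρ₁) k) (lookup (emb ρ₂) k) b)
      (subst (λ t → a₁ ℚ.* lookup (emb ρ₁) k ℚ.+ (t ℚ.* lookup (emb ρ₂) k ℚ.+ b ℚ.* 0ℚ) ≡ 0ℚ) a₂≡0 (relation-at-k r))) a₁≢0)
    where open ℚSolver.+-*-Solver

  related-sym : ∀ {ρ₁ ρ₂} → Outer ρ₁ → Related ρ₁ ρ₂ → Related ρ₂ ρ₁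
  related-sym {ρ₁} {ρ₂} o r@(related a₁ a₂ b a₁≢0 rel) =
    related a₂ a₁ b (second-coefficient o r)
      (relation-from-coordinates a₂ (emb ρ₂) a₁ (emb ρ₁) b (emb γ) λ i → trans
        (solve 6 (λ a₂ v a₁ u b w → a₂ :* v :+ (a₁ :* u :+ b :* w) := a₁ :* u :+ (a₂ :* v :+ b :* w))
               refl a₂ (lookup (emb ρ₂) i) a₁ (lookup (emb ρ₁) i) b (lookup (emb γ) i))
        (relation-at rel i))
    where open ℚSolver.+-*-Solver

  -- Project both to γ⊥ along γ:
  -- the projections are proportional with positive ratio (read off the
  -- k-coordinate), and the γ-components contribute ⟨ρ₁,γ⟩⟨ρ₂,γ⟩/⟨γ,γ⟩ ≥ 0.
  related-acute : ∀ {ρ₁ ρ₂} → Outer ρ₁ → Outer ρ₂ → Related ρ₁ ρ₂ → 0ℚ < ⟪ ρ₁ , ρ₂ ⟫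
  related-acute {ρ₁} {ρ₂} o₁ o₂ (related a₁ a₂ b a₁≢0 rel) =
    subst (0ℚ <_) (sym-form (emb ρ₂) (emb ρ₁)) (pos-factor (subst (0ℚ <_) (ℚP.*-comm g ⟪ ρ₂ , ρ₁ ⟫) g·ρ₂ρ₁>0) g>0)
    where
    g = ⟪ γ , γ ⟫
    p = ⟪ ρ₂ , γ ⟫
    g>0 : 0ℚ < g
    g>0 = norm-pos γ∈Φ
    r₁ = lookup (emb ρ₁) k
    r₂ = lookup (emb ρ₂) k
    -- z = g·ρ₂ − p·γ, the (scaled) projection of ρ₂ to γ⊥
    z = projectAlong (emb γ) (emb γ) (emb ρ₂)
    γ⊥z : ⟨ emb γ , z ⟩ ≡ 0ℚ
    γ⊥z = trans (sym-form (emb γ) z) (projectAlong-⊥ (emb γ) (emb γ) (emb ρ₂))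
    zₖ : lookup z k ≡ g ℚ.* r₂
    zₖ = lookup-projectAlong (emb γ) (emb γ) (emb ρ₂) k γₖ≡0ℚ
    z≢0 : z ≢ zeroV
    z≢0 z≡0 = *-≢0 (pos⇒≢0 g>0) (pos⇒≢0 (outer-kℚ-pos o₂)) (trans (sym zₖ) (trans (cong (λ v → lookup v k) z≡0) (lookup-zeroV k)))
    x₁ = ⟨ emb ρ₁ , z ⟩
    x₂ = ⟨ emb ρ₂ , z ⟩
    x₂>0 : 0ℚ < x₂
    x₂>0 = pos-factor (subst (0ℚ <_) (trans (projectAlong-form (emb γ) (emb γ) (emb ρ₂) z γ⊥z) (ℚP.*-comm g x₂))
                                     (B-posdef z z≢0)) g>0
    -- pairing the relation with z and reading its k-coordinate gives x₁r₂ = x₂r₁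
    x₁r₂≡x₂r₁ : x₁ ℚ.* r₂ ≡ x₂ ℚ.* r₁
    x₁r₂≡x₂r₁ = eliminate {a₁} {a₂} {b} {x₁} {x₂} {⟨ emb γ , z ⟩} {r₁} {r₂} {0ℚ} (relation-paired rel z) (relation-at-k (related a₁ a₂ b a₁≢0 rel)) γ⊥z refl a₁≢0
    x₁>0 : 0ℚ < x₁
    x₁>0 = pos-factor (subst (0ℚ <_) (sym x₁r₂≡x₂r₁) (pos*pos x₂>0 (outer-kℚ-pos o₁))) (outer-kℚ-pos o₂)
    -- g⟨ρ₂,ρ₁⟩ = x₁ + p⟨γ,ρ₁⟩  with  p, ⟨γ,ρ₁⟩ ≤ 0
    decomposition : g ℚ.* ⟪ ρ₂ , ρ₁ ⟫ ≡ x₁ ℚ.+ p ℚ.* ⟪ γ , ρ₁ ⟫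
    decomposition = begin
      g ℚ.* ⟪ ρ₂ , ρ₁ ⟫                                                ≡⟨ solve 3 (λ a p c → a := a :+ (:- p) :* c :+ p :* c) refl (g ℚ.* ⟪ ρ₂ , ρ₁ ⟫) p ⟪ γ , ρ₁ ⟫ ⟩
      g ℚ.* ⟪ ρ₂ , ρ₁ ⟫ ℚ.+ ℚ.- p ℚ.* ⟪ γ , ρ₁ ⟫ ℚ.+ p ℚ.* ⟪ γ , ρ₁ ⟫   ≡⟨ cong (ℚ._+ p ℚ.* ⟪ γ , ρ₁ ⟫) (sym (combˡ g (emb ρ₂) (ℚ.- p) (emb γ) (emb ρ₁))) ⟩
      ⟨ z , emb ρ₁ ⟩ ℚ.+ p ℚ.* ⟪ γ , ρ₁ ⟫                               ≡⟨ cong (ℚ._+ p ℚ.* ⟪ γ , ρ₁ ⟫) (sym-form z (emb ρ₁)) ⟩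
      x₁ ℚ.+ p ℚ.* ⟪ γ , ρ₁ ⟫                                          ∎
      where
      open ≡-Reasoning
      open ℚSolver.+-*-Solver
    g·ρ₂ρ₁>0 : 0ℚ < g ℚ.* ⟪ ρ₂ , ρ₁ ⟫
    g·ρ₂ρ₁>0 = subst (0ℚ <_) (sym decomposition)
      (pos+nonNeg x₁>0 (nonPos*nonPos (obtuse-with-γ o₂) (subst (_≤ 0ℚ) (sym-form (emb ρ₁) (emb γ)) (obtuse-with-γ o₁))))

  measure : Vecℤ n → Vecℤ n → ℕ
  measure ρ₁ ρ₂ = ℤ.∣ lookup ρ₁ k ∣ ℕ.+ ℤ.∣ lookup ρ₂ k ∣

  -- For a related pair of outer roots with hi = lo + f,
  -- f a positive root, the relation rewrites as (a₁+a₂)·lo + a₂·f + b·γ = 0;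
  -- f is outer, differs from lo, (lo, f) is related and has smaller measure.
  module Climb {lo hi f : Vecℤ n} (o-lo : Outer lo) (o-hi : Outer hi)
               (lo≢hi : lo ≢ hi) (r : Related lo hi)
               (f∈Φ : f ∈ Φ) (f≥0 : NonNeg f) (hi≡lo+f : lo +Z f ≡ hi) where
    open Related r

    a₂≢0 : a₂ ≢ 0ℚ
    a₂≢0 = second-coefficient o-lo r

    hi-at : ∀ i → lookup (emb hi) i ≡ lookup (emb lo) i ℚ.+ lookup (emb f) i
    hi-at i = trans (cong (λ v → lookup (emb v) i) (sym hi≡lo+f))
                    (trans (cong (λ v → lookup v i) (emb-+Z lo f)) (lookup-+V (emb lo) (emb f) i))

    shifted : Relation₃ (a₁ ℚ.+ a₂) (emb lo) a₂ (emb f) b (emb γ)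
    shifted = relation-from-coordinates (a₁ ℚ.+ a₂) (emb lo) a₂ (emb f) b (emb γ) λ i → begin
        (a₁ ℚ.+ a₂) ℚ.* lookup (emb lo) i ℚ.+ (a₂ ℚ.* lookup (emb f) i ℚ.+ b ℚ.* lookup (emb γ) i)
          ≡⟨ solve 6 (λ a₁ a₂ b l f g → (a₁ :+ a₂) :* l :+ (a₂ :* f :+ b :* g) := a₁ :* l :+ (a₂ :* (l :+ f) :+ b :* g))
                   refl a₁ a₂ b (lookup (emb lo) i) (lookup (emb f) i) (lookup (emb γ) i) ⟩
        a₁ ℚ.* lookup (emb lo) i ℚ.+ (a₂ ℚ.* (lookup (emb lo) i ℚ.+ lookup (emb f) i) ℚ.+ b ℚ.* lookup (emb γ) i)
          ≡⟨ cong (λ t → a₁ ℚ.* lookup (emb lo) i ℚ.+ (a₂ ℚ.* t ℚ.+ b ℚ.* lookup (emb γ) i)) (sym (hi-at i)) ⟩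
        a₁ ℚ.* lookup (emb lo) i ℚ.+ (a₂ ℚ.* lookup (emb hi) i ℚ.+ b ℚ.* lookup (emb γ) i)
          ≡⟨ relation-at rel i ⟩
        0ℚ ∎
      where
      open ≡-Reasoning
      open ℚSolver.+-*-Solver

    shifted-at-k : (a₁ ℚ.+ a₂) ℚ.* lookup (emb lo) k ℚ.+ (a₂ ℚ.* lookup (emb f) k ℚ.+ b ℚ.* 0ℚ) ≡ 0ℚ
    shifted-at-k = subst (λ t → (a₁ ℚ.+ a₂) ℚ.* lookup (emb lo) k ℚ.+ (a₂ ℚ.* lookup (emb f) k ℚ.+ b ℚ.* t) ≡ 0ℚ)
                         γₖ≡0ℚ (relation-at shifted k)

    f∉I : ¬ I f
    f∉I f∈I = proj₂ (proj₂ o-hi) (ideal-sum f∈I (proj₁ o-lo) (trans (+Z-comm f lo) hi≡lo+f) (proj₁ (proj₁ o-hi)))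

    -- f ∈ Φ₀ is impossible: then a₁ + a₂ = 0, so a₂f + bγ = 0 forces
    -- f = γ (f and γ are positive), and hi = γ + lo ∈ I
    f∉Φ₀ : lookup f k ≢ + 0
    f∉Φ₀ fₖ≡0 = conclude (reduced γ f γ∈Φ f∈Φ (dependent₂ b (emb γ) a₂ (emb f) (inj₂ a₂≢0) f∥γ))
      where
      open ℚSolver.+-*-Solver
      fₖ≡0ℚ : lookup (emb f) k ≡ 0ℚ
      fₖ≡0ℚ = trans (lookup-emb f k) (cong ι fₖ≡0)
      a₁+a₂≡0 : a₁ ℚ.+ a₂ ≡ 0ℚ
      a₁+a₂≡0 = zero-product (trans (ℚP.*-comm (lookup (emb lo) k) (a₁ ℚ.+ a₂))
        (trans (solve 4 (λ s l a b → s :* l := s :* l :+ (a :* con 0ℚ :+ b :* con 0ℚ)) refl (a₁ ℚ.+ a₂) (lookup (emb lo) k) a₂ b)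
               (subst (λ t → (a₁ ℚ.+ a₂) ℚ.* lookup (emb lo) k ℚ.+ (a₂ ℚ.* t ℚ.+ b ℚ.* 0ℚ) ≡ 0ℚ) fₖ≡0ℚ shifted-at-k)))
        (pos⇒≢0 (outer-kℚ-pos o-lo))
      f∥γ : ∀ i → b ℚ.* lookup (emb γ) i ℚ.+ a₂ ℚ.* lookup (emb f) i ≡ 0ℚ
      f∥γ i = trans (solve 5 (λ l a f g b → b :* g :+ a :* f := con 0ℚ :* l :+ (a :* f :+ b :* g)) refl
                       (lookup (emb lo) i) a₂ (lookup (emb f) i) (lookup (emb γ) i) b)
                    (trans (cong (λ t → t ℚ.* lookup (emb lo) i ℚ.+ (a₂ ℚ.* lookup (emb f) i ℚ.+ b ℚ.* lookup (emb γ) i)) (sym a₁+a₂≡0))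
                           (relation-at shifted i))
      conclude : f ≡ γ ⊎ f ≡ negZ γ → ⊥
      conclude (inj₁ f≡γ) = proj₂ (proj₂ o-hi)
        (ideal-sum γ∈I (proj₁ o-lo) (trans (cong (_+Z lo) (sym f≡γ)) (trans (+Z-comm f lo) hi≡lo+f)) (proj₁ (proj₁ o-hi)))
      conclude (inj₂ f≡-γ) = nonNeg-both-signs γ∈Φ (proj₂ γ-pos) (subst NonNeg f≡-γ f≥0)

    f-outer : Outer f
    f-outer = (f∈Φ , f≥0) , f∉Φ₀ , f∉I

    -- lo ≠ f, since otherwise hi = 2·lo would be proportional to lo
    lo≢f : lo ≢ f
    lo≢f lo≡f = independent (proj₁ (proj₁ o-lo)) (proj₁ (proj₁ o-hi)) hi≢lo hi≢-lo
      (dependent₂ (ι (+ 2)) (emb lo) (ℚ.- 1ℚ) (emb hi) (inj₁ (λ ())) twice)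
      where
      open ℚSolver.+-*-Solver
      twice : ∀ i → ι (+ 2) ℚ.* lookup (emb lo) i ℚ.+ ℚ.- 1ℚ ℚ.* lookup (emb hi) i ≡ 0ℚ
      twice i = begin
        ι (+ 2) ℚ.* lookup (emb lo) i ℚ.+ ℚ.- 1ℚ ℚ.* lookup (emb hi) i
          ≡⟨ cong (λ t → ι (+ 2) ℚ.* lookup (emb lo) i ℚ.+ ℚ.- 1ℚ ℚ.* t) (hi-at i) ⟩
        ι (+ 2) ℚ.* lookup (emb lo) i ℚ.+ ℚ.- 1ℚ ℚ.* (lookup (emb lo) i ℚ.+ lookup (emb f) i)
          ≡⟨ cong (λ v → ι (+ 2) ℚ.* lookup (emb lo) i ℚ.+ ℚ.- 1ℚ ℚ.* (lookup (emb lo) i ℚ.+ lookup (emb v) i)) (sym lo≡f) ⟩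
        ι (+ 2) ℚ.* lookup (emb lo) i ℚ.+ ℚ.- 1ℚ ℚ.* (lookup (emb lo) i ℚ.+ lookup (emb lo) i)
          ≡⟨ solve 1 (λ x → con (ι (+ 2)) :* x :+ (:- con 1ℚ) :* (x :+ x) := con 0ℚ) refl (lookup (emb lo) i) ⟩
        0ℚ ∎
        where open ≡-Reasoning
      hi≢lo : hi ≢ lo
      hi≢lo hi≡lo = lo≢hi (sym hi≡lo)
      hi≢-lo : hi ≢ negZ lo
      hi≢-lo hi≡-lo = nonNeg-both-signs (proj₁ (proj₁ o-lo)) (proj₂ (proj₁ o-lo)) (subst NonNeg hi≡-lo (proj₂ (proj₁ o-hi)))

    lo-f-related : Related lo f
    lo-f-related = related (a₁ ℚ.+ a₂) a₂ b sum≢0 shifted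
      where
      open ℚSolver.+-*-Solver
      sum≢0 : a₁ ℚ.+ a₂ ≢ 0ℚ
      sum≢0 sum≡0 = ι-≢0 f∉Φ₀ (trans (sym (lookup-emb f k)) (zero-product (trans
        (solve 4 (λ l a f b → a :* f := con 0ℚ :* l :+ (a :* f :+ b :* con 0ℚ)) refl (lookup (emb lo) k) a₂ (lookup (emb f) k) b)
        (subst (λ t → t ℚ.* lookup (emb lo) k ℚ.+ (a₂ ℚ.* lookup (emb f) k ℚ.+ b ℚ.* 0ℚ) ≡ 0ℚ) sum≡0 shifted-at-k)) a₂≢0))

    -- in coordinate k the step reads hi_k = lo_k + f_k with lo_k > 0
    descends : measure lo f ℕ.< measure lo hi
    descends = subst (ℕ._< measure lo hi) hi-measure (ℕP.m<n+m _ (∣∣-pos (outer-k-pos o-lo)))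
      where
      hi-measure : ℤ.∣ lookup hi k ∣ ≡ measure lo f
      hi-measure = trans (cong (λ v → ℤ.∣ lookup v k ∣) (sym hi≡lo+f))
                         (trans (cong ℤ.∣_∣ (lookup-+Z lo f k))
                                (∣+∣-nonNeg (VAllP.lookup⁺ (proj₂ (proj₁ o-lo)) k) (VAllP.lookup⁺ f≥0 k)))

  no-relation : ∀ N {ρ₁ ρ₂} → measure ρ₁ ρ₂ ℕ.< N → Outer ρ₁ → Outer ρ₂ → ρ₁ ≢ ρ₂ → ¬ Related ρ₁ ρ₂
  no-relation zero () _ _ _ _
  no-relation (suc N) {ρ₁} {ρ₂} bound o₁ o₂ ρ₁≢ρ₂ r = by-sign (signs (ρ₂ -Z ρ₁) d∈Φ)
    where
    -- related outer roots make an acute angle, so they differ by a root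
    d∈Φ : (ρ₂ -Z ρ₁) ∈ Φ
    d∈Φ = difference-root (proj₁ (proj₁ o₁)) (proj₁ (proj₁ o₂)) (λ e → ρ₁≢ρ₂ (sym e))
            (λ e → nonNeg-both-signs (proj₁ (proj₁ o₁)) (proj₂ (proj₁ o₁)) (subst NonNeg e (proj₂ (proj₁ o₂))))
            (related-acute o₁ o₂ r)
    -- the smaller root, the larger one and their difference, as a pair
    -- (lo, hi) with hi = lo + f, recursing on the related pair (lo, f)
    step : ∀ {lo hi f} → measure lo hi ℕ.< suc N → Outer lo → Outer hi → lo ≢ hi → Related lo hi →
           f ∈ Φ → NonNeg f → lo +Z f ≡ hi → ⊥
    step bound′ o-lo o-hi lo≢hi r′ f∈Φ f≥0 hi≡lo+f =
      no-relation N (ℕP.<-≤-trans descends (ℕP.≤-pred bound′)) o-lo f-outer lo≢f lo-f-related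
      where open Climb o-lo o-hi lo≢hi r′ f∈Φ f≥0 hi≡lo+f
    by-sign : NonNeg (ρ₂ -Z ρ₁) ⊎ VAll.All (ℤ._≤ + 0) (ρ₂ -Z ρ₁) → ⊥
    by-sign (inj₁ d≥0) = step bound o₁ o₂ ρ₁≢ρ₂ r d∈Φ d≥0 (+Z--Z ρ₁ ρ₂)
    by-sign (inj₂ d≤0) =
      step (subst (ℕ._< suc N) (ℕP.+-comm ℤ.∣ lookup ρ₁ k ∣ ℤ.∣ lookup ρ₂ k ∣) bound) o₂ o₁ (λ e → ρ₁≢ρ₂ (sym e))
           (related-sym o₁ r) (difference-root-sym d∈Φ) (nonNeg-neg d≤0) (+Z--Z ρ₂ ρ₁)
      where
      nonNeg-neg : VAll.All (ℤ._≤ + 0) (ρ₂ -Z ρ₁) → NonNeg (ρ₁ -Z ρ₂)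
      nonNeg-neg d≤0 = VAllP.lookup⁻ λ i →
        subst (+ 0 ℤ.≤_) (trans (sym (lookup-negZ (ρ₂ -Z ρ₁) i)) (cong (λ v → lookup v i) (negZ--Z ρ₂ ρ₁)))
              (ℤP.neg-mono-≤ (VAllP.lookup⁺ d≤0 i))

module Flats {n : ℕ} (R : RootSystemWithBase n) where
  open RootSystemWithBase R
  open RootSystemFacts R
  open module Sep (k : Fin n) = Separation B B-sym B-posdef k using (InHyperplane; restriction-reflects)

  Flat : List (Vecℤ n) → Sub n
  Flat L = ⋂ (List.map (H R) L)

  flat⇒⊥ : ∀ {x} L → Flat L x → ⊥-all x (List.map emb L)
  flat⇒⊥ [] _ = []
  flat⇒⊥ (γ ∷ L) (x∈H , x∈Flat) = x∈H ∷ flat⇒⊥ L x∈Flat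

  ⊥⇒flat : ∀ {x} L → ⊥-all x (List.map emb L) → Flat L x
  ⊥⇒flat [] [] = tt
  ⊥⇒flat (γ ∷ L) (x⊥γ ∷ x⊥L) = x⊥γ , ⊥⇒flat L x⊥L

  Φ₀-in-plane : ∀ k {L} → All (λ γ → lookup γ k ≡ + 0) L → All (InHyperplane k) (List.map emb L)
  Φ₀-in-plane k [] = []
  Φ₀-in-plane k {γ ∷ _} (γₖ ∷ Lₖ) = trans (lookup-emb γ k) (cong ι γₖ) ∷ Φ₀-in-plane k Lₖ

  flats-reflected : ∀ k δ L₁ L₂ → lookup δ k ≢ + 0 →
    All (λ γ → lookup γ k ≡ + 0) L₁ → All (λ γ → lookup γ k ≡ + 0) L₂ →
    (H R δ ∩ Flat L₁) ⊆ Flat L₂ → Flat L₁ ⊆ Flat L₂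
  flats-reflected k δ L₁ L₂ δₖ≢0 L₁ₖ L₂ₖ on-Hδ x x∈L₁ =
    ⊥⇒flat L₂ (restriction-reflects k (List.map emb L₁) (List.map emb L₂) (emb δ)
      (Φ₀-in-plane k L₁ₖ) (Φ₀-in-plane k L₂ₖ)
      (λ eq → ι-≢0 δₖ≢0 (trans (sym (lookup-emb δ k)) eq))
      (λ y y⊥δ y⊥L₁ → flat⇒⊥ L₂ (on-Hδ y (y⊥δ , ⊥⇒flat L₁ y⊥L₁)))
      x (flat⇒⊥ L₁ x∈L₁))

module Restriction {n : ℕ} (R : RootSystemWithBase n) (I : Vecℤ n → Set) (isI : IsIdeal R I)
                   (k : Fin n) (condC : ConditionC R I k)
                   (δ : Vecℤ n) (hδ : Φ₀ᶜ R k δ × ¬ I δ) where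
  open RootSystemWithBase R
  open RootSystemFacts R
  open Flats R

  δ-pos : Pos R δ
  δ-pos = proj₁ (proj₁ hδ)

  δₖ≢0 : lookup δ k ≢ + 0
  δₖ≢0 δₖ≡0 = proj₂ (proj₁ hδ) ((proj₁ δ-pos , δₖ≡0) , δ-pos)

  ≐-refl : ∀ {Y : Sub n} → Y ≐ Y
  ≐-refl = (λ _ y → y) , (λ _ y → y)

  A₀-in-Φ₀ : ∀ {L} → All (A₀ R I k) L → All (λ γ → lookup γ k ≡ + 0) L
  A₀-in-Φ₀ [] = []
  A₀-in-Φ₀ (a ∷ as) = proj₂ (proj₁ (proj₁ a)) ∷ A₀-in-Φ₀ as

  trace-reflects : ∀ {L₁ L₂} → All (A₀ R I k) L₁ → All (A₀ R I k) L₂ →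
                   (H R δ ∩ Flat L₁) ⊆ Flat L₂ → Flat L₁ ⊆ Flat L₂
  trace-reflects {L₁} {L₂} as₁ as₂ = flats-reflected k δ L₁ L₂ δₖ≢0 (A₀-in-Φ₀ as₁) (A₀-in-Φ₀ as₂)

  -- each hyperplane of 𝒜_{I₀} is a hyperplane of 𝒜_I other than H_δ:
  -- H_δ ⊆ H_γ would give V ⊆ H_γ by trace-reflects, so γ ⊥ γ
  A₀⇒ResRoot : ∀ {γ} → A₀ R I k γ → ResRoot R I δ γ
  A₀⇒ResRoot {γ} (γ∈Φ₀⁺ , γ∉I₀) = (proj₂ γ∈Φ₀⁺ , λ γ∈I → γ∉I₀ (γ∈I , γ∈Φ₀⁺)) , Hγ≢Hδ
    where
    Hγ≢Hδ : ¬ (H R γ ≐ H R δ)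
    Hγ≢Hδ (_ , Hδ⊆Hγ) = pos⇒≢0 (norm-pos (proj₁ (proj₂ γ∈Φ₀⁺)))
      (proj₁ (trace-reflects {[]} {γ ∷ []} [] ((γ∈Φ₀⁺ , γ∉I₀) ∷ [])
                (λ x (x∈Hδ , _) → Hδ⊆Hγ x x∈Hδ , tt) (emb γ) tt))

  same-trace : ∀ {α γ c₁ c₂ c₃} → Relation₃ c₁ (emb α) c₂ (emb δ) c₃ (emb γ) →
               c₁ ≢ 0ℚ → c₃ ≢ 0ℚ → (H R δ ∩ H R α) ≐ (H R δ ∩ H R γ)
  same-trace {α} {γ} {c₁} {c₂} {c₃} rel c₁≢0 c₃≢0 =
    (λ x (x⊥δ , x⊥α) → x⊥δ , zero-product (solve-for-γ x x⊥δ x⊥α) c₃≢0) ,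
    (λ x (x⊥δ , x⊥γ) → x⊥δ , zero-product (solve-for-α x x⊥δ x⊥γ) c₁≢0)
    where
    open ℚSolver.+-*-Solver
    paired : ∀ x → c₁ ℚ.* ⟨ x , emb α ⟩ ℚ.+ (c₂ ℚ.* ⟨ x , emb δ ⟩ ℚ.+ c₃ ℚ.* ⟨ x , emb γ ⟩) ≡ 0ℚ
    paired x = trans (cong₂ (λ p q → c₁ ℚ.* p ℚ.+ (c₂ ℚ.* q ℚ.+ c₃ ℚ.* ⟨ x , emb γ ⟩)) (sym-form x (emb α)) (sym-form x (emb δ)))
              (trans (cong (λ t → c₁ ℚ.* ⟨ emb α , x ⟩ ℚ.+ (c₂ ℚ.* ⟨ emb δ , x ⟩ ℚ.+ c₃ ℚ.* t)) (sym-form x (emb γ)))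
                     (relation-paired rel x))
    solve-for-γ : ∀ x → ⟨ x , emb δ ⟩ ≡ 0ℚ → ⟨ x , emb α ⟩ ≡ 0ℚ → c₃ ℚ.* ⟨ x , emb γ ⟩ ≡ 0ℚ
    solve-for-γ x x⊥δ x⊥α = trans
      (solve 3 (λ a b c → c := a :* con 0ℚ :+ (b :* con 0ℚ :+ c)) refl c₁ c₂ (c₃ ℚ.* ⟨ x , emb γ ⟩))
      (trans (cong₂ (λ p q → c₁ ℚ.* p ℚ.+ (c₂ ℚ.* q ℚ.+ c₃ ℚ.* ⟨ x , emb γ ⟩)) (sym x⊥α) (sym x⊥δ)) (paired x))
    solve-for-α : ∀ x → ⟨ x , emb δ ⟩ ≡ 0ℚ → ⟨ x , emb γ ⟩ ≡ 0ℚ → c₁ ℚ.* ⟨ x , emb α ⟩ ≡ 0ℚ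
    solve-for-α x x⊥δ x⊥γ = trans
      (solve 3 (λ a b c → a := a :+ (b :* con 0ℚ :+ c :* con 0ℚ)) refl (c₁ ℚ.* ⟨ x , emb α ⟩) c₂ c₃)
      (trans (cong₂ (λ p q → c₁ ℚ.* ⟨ x , emb α ⟩ ℚ.+ (c₂ ℚ.* p ℚ.+ c₃ ℚ.* q)) (sym x⊥δ) (sym x⊥γ)) (paired x))

  -- In a nontrivial relation c₁α + c₂δ + c₃γ = 0 between positive roots
  -- α ≠ δ and γ ∈ Φ₀ both c₃ ≠ 0 (α, δ are independent) and c₁ ≠ 0
  -- (otherwise the k-coordinate gives c₂ = 0 and then γ = 0).
  outer-coefficients : ∀ {α γ c₁ c₂ c₃} → Pos R α → α ≢ δ → Φ₀⁺ R k γ →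
    Any (_≢ 0ℚ) (c₁ ∷ c₂ ∷ c₃ ∷ []) → Relation₃ c₁ (emb α) c₂ (emb δ) c₃ (emb γ) → c₁ ≢ 0ℚ × c₃ ≢ 0ℚ
  outer-coefficients {α} {γ} {c₁} {c₂} {c₃} (α∈Φ , α≥0) α≢δ ((γ∈Φ , γₖ≡0) , _) nontrivial rel = c₁≢0 , c₃≢0
    where
    open ℚSolver.+-*-Solver
    c₃≢0 : c₃ ≢ 0ℚ
    c₃≢0 c₃≡0 = independent α∈Φ (proj₁ δ-pos) (λ e → α≢δ (sym e))
      (λ e → nonNeg-both-signs α∈Φ α≥0 (subst NonNeg e (proj₂ δ-pos)))
      (dependent₂ c₁ (emb α) c₂ (emb δ) (first-two nontrivial) λ i → trans
        (solve 5 (λ a x b y g → a :* x :+ b :* y := a :* x :+ (b :* y :+ con 0ℚ :* g)) refl c₁ (lookup (emb α) i) c₂ (lookup (emb δ) i) (lookup (emb γ) i))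
        (trans (cong (λ t → c₁ ℚ.* lookup (emb α) i ℚ.+ (c₂ ℚ.* lookup (emb δ) i ℚ.+ t ℚ.* lookup (emb γ) i)) (sym c₃≡0))
               (relation-at rel i)))
      where
      first-two : Any (_≢ 0ℚ) (c₁ ∷ c₂ ∷ c₃ ∷ []) → c₁ ≢ 0ℚ ⊎ c₂ ≢ 0ℚ
      first-two (here c₁≢0) = inj₁ c₁≢0
      first-two (there (here c₂≢0)) = inj₂ c₂≢0
      first-two (there (there (here c₃≢0′))) = ⊥-elim (c₃≢0′ c₃≡0)
    c₁≢0 : c₁ ≢ 0ℚ
    c₁≢0 c₁≡0 = emb-≢0 γ (nonzero γ γ∈Φ) (vec-ext _ _ λ i → trans (zero-product (γ-part i) c₃≢0) (sym (lookup-zeroV i)))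
      where
      δₖ≢0ℚ : lookup (emb δ) k ≢ 0ℚ
      δₖ≢0ℚ eq = ι-≢0 δₖ≢0 (trans (sym (lookup-emb δ k)) eq)
      γₖ≡0ℚ : lookup (emb γ) k ≡ 0ℚ
      γₖ≡0ℚ = trans (lookup-emb γ k) (cong ι γₖ≡0)
      rest : ∀ i → c₂ ℚ.* lookup (emb δ) i ℚ.+ c₃ ℚ.* lookup (emb γ) i ≡ 0ℚ
      rest i = trans (solve 3 (λ x d g → d :+ g := con 0ℚ :* x :+ (d :+ g)) refl (lookup (emb α) i) (c₂ ℚ.* lookup (emb δ) i) (c₃ ℚ.* lookup (emb γ) i))
                     (trans (cong (λ t → t ℚ.* lookup (emb α) i ℚ.+ (c₂ ℚ.* lookup (emb δ) i ℚ.+ c₃ ℚ.* lookup (emb γ) i)) (sym c₁≡0))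
                            (relation-at rel i))
      c₂≡0 : c₂ ≡ 0ℚ
      c₂≡0 = zero-product (trans (ℚP.*-comm (lookup (emb δ) k) c₂)
               (trans (solve 3 (λ c d s → c :* d := c :* d :+ s :* con 0ℚ) refl c₂ (lookup (emb δ) k) c₃)
                      (trans (cong (λ t → c₂ ℚ.* lookup (emb δ) k ℚ.+ c₃ ℚ.* t) (sym γₖ≡0ℚ)) (rest k)))) δₖ≢0ℚ
      γ-part : ∀ i → c₃ ℚ.* lookup (emb γ) i ≡ 0ℚ
      γ-part i = trans (solve 3 (λ d s g → s :* g := con 0ℚ :* d :+ s :* g) refl (lookup (emb δ) i) c₃ (lookup (emb γ) i))
                       (trans (cong (λ t → t ℚ.* lookup (emb δ) i ℚ.+ c₃ ℚ.* lookup (emb γ) i) (sym c₂≡0)) (rest i))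

  -- For α ∈ Φ₀ take α itself; otherwise Condition (C) gives γ ∈ Φ₀⁺
  -- dependent on α and δ, which has the same trace, and γ ∉ I by the
  -- descent (α and δ would be related to γ).
  trace-of-A₀ : ∀ {α} → ResRoot R I δ α → ∃[ γ ] A₀ R I k γ × (H R δ ∩ H R α) ≐ (H R δ ∩ H R γ)
  trace-of-A₀ {α} ((α-pos , α∉I) , Hα≢Hδ) = by-cases (lookup α k ℤ.≟ + 0)
    where
    α≢δ : α ≢ δ
    α≢δ refl = Hα≢Hδ ≐-refl
    by-cases : Dec (lookup α k ≡ + 0) → ∃[ γ ] A₀ R I k γ × (H R δ ∩ H R α) ≐ (H R δ ∩ H R γ)
    by-cases (yes αₖ≡0) = α , ((α∈Φ₀⁺ , λ α∈I₀ → α∉I (proj₁ α∈I₀)) , ≐-refl)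
      where α∈Φ₀⁺ = (proj₁ α-pos , αₖ≡0) , α-pos
    by-cases (no αₖ≢0) = from-dependence (proj₂ (proj₂ (proj₂ condC)) α δ α-outer δ-outer α≢δ)
      where
      α-outer : Φ₀ᶜ R k α × Compl R I α
      α-outer = (α-pos , λ α∈Φ₀⁺ → αₖ≢0 (proj₂ (proj₁ α∈Φ₀⁺))) , (α-pos , α∉I)
      δ-outer : Φ₀ᶜ R k δ × Compl R I δ
      δ-outer = proj₁ hδ , (δ-pos , proj₂ hδ)
      from-dependence : ∃[ γ ] Φ₀⁺ R k γ × LinDep (emb α ∷ emb δ ∷ emb γ ∷ []) →
                        ∃[ γ ] A₀ R I k γ × (H R δ ∩ H R α) ≐ (H R δ ∩ H R γ)
      from-dependence (γ , γ∈Φ₀⁺ , (c₁ ∷ c₂ ∷ c₃ ∷ [] , refl , nontrivial , combination)) =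
        γ , (γ∈Φ₀⁺ , γ∉I₀) , same-trace rel c₁≢0 c₃≢0
        where
        rel : Relation₃ c₁ (emb α) c₂ (emb δ) c₃ (emb γ)
        rel = relation (trans (cong (λ v → (c₁ ·V emb α) +V ((c₂ ·V emb δ) +V v)) (sym (+V-zeroV (c₃ ·V emb γ)))) combination)
        c₁≢0 = proj₁ (outer-coefficients α-pos α≢δ γ∈Φ₀⁺ nontrivial rel)
        c₃≢0 = proj₂ (outer-coefficients α-pos α≢δ γ∈Φ₀⁺ nontrivial rel)
        γ∉I₀ : ¬ I₀ R I k γ
        γ∉I₀ (γ∈I , _) = Descent.no-relation R I isI k γ γ∈I (proj₂ (proj₁ γ∈Φ₀⁺))
          (suc (Descent.measure R I isI k γ γ∈I (proj₂ (proj₁ γ∈Φ₀⁺)) α δ)) (ℕP.n<1+n _)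
          (α-pos , αₖ≢0 , α∉I) (δ-pos , δₖ≢0 , proj₂ hδ) α≢δ (Descent.related c₁ c₂ c₃ c₁≢0 rel)
      from-dependence (_ , _ , ([] , () , _))
      from-dependence (_ , _ , (_ ∷ [] , () , _))
      from-dependence (_ , _ , (_ ∷ _ ∷ [] , () , _))
      from-dependence (_ , _ , (_ ∷ _ ∷ _ ∷ _ ∷ _ , () , _))

  traces-of-A₀ : ∀ {L} → All (ResRoot R I δ) L →
                 Σ (List (Vecℤ n)) λ L′ → All (A₀ R I k) L′ × (H R δ ∩ Flat L) ≐ (H R δ ∩ Flat L′)
  traces-of-A₀ [] = [] , [] , ≐-refl
  traces-of-A₀ (r ∷ rs) with trace-of-A₀ r | traces-of-A₀ rs
  ... | γ , a , (α⇒γ , γ⇒α) | L′ , as , (L⇒L′ , L′⇒L) = γ ∷ L′ , a ∷ as ,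
    (λ x (x∈Hδ , x∈Hα , x∈L) → x∈Hδ , proj₂ (α⇒γ x (x∈Hδ , x∈Hα)) , proj₂ (L⇒L′ x (x∈Hδ , x∈L))) ,
    (λ x (x∈Hδ , x∈Hγ , x∈L′) → x∈Hδ , proj₂ (γ⇒α x (x∈Hδ , x∈Hγ)) , proj₂ (L′⇒L x (x∈Hδ , x∈L′)))

  trace-injective : ∀ {γ γ′} → A₀ R I k γ → A₀ R I k γ′ →
                    (H R δ ∩ H R γ) ≐ (H R δ ∩ H R γ′) → H R γ ≐ H R γ′
  trace-injective a a′ (γ⇒γ′ , γ′⇒γ) = one-way a a′ γ⇒γ′ , one-way a′ a γ′⇒γ
    where
    one-way : ∀ {γ γ′} → A₀ R I k γ → A₀ R I k γ′ → (H R δ ∩ H R γ) ⊆ (H R δ ∩ H R γ′) → H R γ ⊆ H R γ′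
    one-way a a′ inc x x∈Hγ = proj₁ (trace-reflects (a ∷ []) (a′ ∷ [])
      (λ y (y∈Hδ , y∈Hγ , _) → proj₂ (inc y (y∈Hδ , y∈Hγ)) , tt) x (x∈Hγ , tt))

  trace-of-flat : ∀ {Y} → FlatA₀ R I k Y → FlatRes R I δ (Y ∩ H R δ)
  trace-of-flat (L , as , (Y⊆L , L⊆Y)) =
    L , All.map A₀⇒ResRoot as ,
    (λ x (x∈Y , x∈Hδ) → x∈Hδ , Y⊆L x x∈Y) , (λ x (x∈Hδ , x∈L) → L⊆Y x x∈L , x∈Hδ)

  flat-trace-reflects : ∀ {Y Z} → FlatA₀ R I k Y → FlatA₀ R I k Z → (Y ∩ H R δ) ⊆ (Z ∩ H R δ) → Y ⊆ Z
  flat-trace-reflects (L₁ , as₁ , (Y⊆L₁ , L₁⊆Y)) (L₂ , as₂ , (Z⊆L₂ , L₂⊆Z)) traces x x∈Y =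
    L₂⊆Z x (trace-reflects as₁ as₂
      (λ y (y∈Hδ , y∈L₁) → Z⊆L₂ y (proj₁ (traces y (L₁⊆Y y y∈L₁ , y∈Hδ)))) x (Y⊆L₁ x x∈Y))

  flat-of-trace : ∀ {W} → FlatRes R I δ W → ∃[ Y ] FlatA₀ R I k Y × (Y ∩ H R δ) ≐ W
  flat-of-trace (L , rs , (W⊆L , L⊆W)) with traces-of-A₀ rs
  ... | L′ , as , (L⇒L′ , L′⇒L) =
    Flat L′ , (L′ , as , ≐-refl) ,
    (λ x (x∈L′ , x∈Hδ) → L⊆W x (L′⇒L x (x∈Hδ , x∈L′))) , (λ x x∈W → swap (L⇒L′ x (W⊆L x x∈W)))

lemma3p6 : ∀ {n : ℕ} (R : RootSystemWithBase n)
    (I : Vecℤ n → Set) → IsIdeal R I →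
    (k : Fin n) → ConditionC R I k →
    (δ : Vecℤ n) → Φ₀ᶜ R k δ × ¬ I δ →
    IsoRestriction R I k δ
lemma3p6 R I isI k condC δ hδ = record
  { hyp-into = λ γ a → γ , A₀⇒ResRoot a , ≐-refl
  ; hyp-inj  = λ γ γ′ → trace-injective
  ; hyp-surj = λ α → trace-of-A₀
  ; lat-into = λ Y → trace-of-flat
  ; lat-mono = λ Y Z _ _ Y⊆Z x (x∈Y , x∈Hδ) → Y⊆Z x x∈Y , x∈Hδ
  ; lat-refl = λ Y Z → flat-trace-reflects
  ; lat-surj = λ W → flat-of-trace
  }
  where open Restriction R I isI k condC δ hδ
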